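{- For each positive integer $n$, the following identity holds in the field $\mathbb{Q}(z)$ of rational functions in an indeterminate $z$: $$\sum_{T\in\mathcal{B}(n)} \prod_{v\in T} \frac{(z+h_v)^{h_v-1}}{h_v\,(2z+h_v-1)^{h_v-2}} = \frac{2^n z}{n!}(n+z)^{n-1}.$$
   Context: $\mathcal{B}(n)$ denotes the set of all binary trees with $n$ vertices (each vertex has an optional left child and an optional right child, left and right being distinguished). For a vertex $v$ of a binary tree $T$, the hook length $h_v$ is the number of descendants of $v$ in $T$, counting $v$ itself. The product is over all vertices $v$ of $T$. Negative exponents are allowed (e.g. when $h_v=1$ the factor is $(z+1)^0/(1\cdot(2z)^{ -1})=2z$). -}

module Defs where

open import Data.Nat as ℕ using (ℕ; zero; suc)
open import Data.Integer as ℤ using (ℤ; +_; -[1+_])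
open import Data.Rational as ℚ using (ℚ; 0ℚ; 1ℚ)
open import Data.List using (List; []; _∷_; foldr)
open import Data.List.Relation.Unary.All using (All)
open import Relation.Binary.PropositionalEquality using (_≡_)

-- Polynomials in z over ℚ: coefficient lists, lowest degree first.

Poly : Set
Poly = List ℚ

infixl 6 _+P_ _-P_
infixl 7 _*P_ _·P_

_+P_ : Poly → Poly → Poly
[]       +P q        = q
(a ∷ p)  +P []       = a ∷ p
(a ∷ p)  +P (b ∷ q)  = (a ℚ.+ b) ∷ (p +P q)

_·P_ : ℚ → Poly → Poly
c ·P []      = []
c ·P (a ∷ p) = (c ℚ.* a) ∷ (c ·P p)

negP : Poly → Poly
negP p = (ℚ.- 1ℚ) ·P p

_-P_ : Poly → Poly → Poly
p -P q = p +P negP q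

_*P_ : Poly → Poly → Poly
[]      *P q = []
(a ∷ p) *P q = (a ·P q) +P (0ℚ ∷ (p *P q))

constP : ℚ → Poly
constP c = c ∷ []

zP : Poly
zP = 0ℚ ∷ 1ℚ ∷ []

_^P_ : Poly → ℕ → Poly
p ^P zero  = constP 1ℚ
p ^P suc n = p *P (p ^P n)

ℕ→ℚ : ℕ → ℚ
ℕ→ℚ n = (+ n) ℚ./ 1

ℤ→ℚ : ℤ → ℚ
ℤ→ℚ k = k ℚ./ 1

IsZeroP : Poly → Set
IsZeroP p = All (_≡ 0ℚ) p

-- The field ℚ(z): fractions num / den of polynomials, with the usual
-- equality  a/b ≈ c/d  iff  a·d − c·b = 0 in ℚ[z].

record RatFun : Set where
  constructor _⁄_
  field
    num : Poly
    den : Poly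
open RatFun public

infix 4 _≈R_
_≈R_ : RatFun → RatFun → Set
(a ⁄ b) ≈R (c ⁄ d) = IsZeroP ((a *P d) -P (c *P b))

infixl 6 _+R_
infixl 7 _*R_

_+R_ : RatFun → RatFun → RatFun
(a ⁄ b) +R (c ⁄ d) = ((a *P d) +P (c *P b)) ⁄ (b *P d)

_*R_ : RatFun → RatFun → RatFun
(a ⁄ b) *R (c ⁄ d) = (a *P c) ⁄ (b *P d)

0R 1R : RatFun
0R = [] ⁄ constP 1ℚ
1R = constP 1ℚ ⁄ constP 1ℚ

polyR : Poly → RatFun
polyR p = p ⁄ constP 1ℚ

invR : RatFun → RatFun
invR (a ⁄ b) = b ⁄ a

_^R_ : RatFun → ℕ → RatFun
f ^R zero  = 1R
f ^R suc n = f *R (f ^R n)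

_^Rℤ_ : RatFun → ℤ → RatFun
f ^Rℤ (+ n)     = f ^R n
f ^Rℤ -[1+ n ]  = invR f ^R suc n

sumR : List RatFun → RatFun
sumR = foldr _+R_ 0R

-- Binary trees (left/right distinguished); `empty` is the empty tree.

data BTree : Set where
  empty : BTree
  node  : BTree → BTree → BTree

size : BTree → ℕ
size empty      = 0
size (node l r) = suc (size l ℕ.+ size r)

hookFactor : ℕ → RatFun
hookFactor h =
  (polyR (zP +P constP (ℕ→ℚ h)) ^Rℤ (+ h ℤ.- + 1))
  *R invR (polyR (constP (ℕ→ℚ h))
           *R (polyR ((ℕ→ℚ 2 ·P zP) +P constP (ℤ→ℚ (+ h ℤ.- + 1))) ^Rℤ (+ h ℤ.- + 2)))

-- Product over all vertices v of T of hookFactor(h_v); the hook length of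
-- the root of a subtree is the size of that subtree.
hookProd : BTree → RatFun
hookProd empty          = 1R
hookProd t@(node l r)   = hookFactor (size t) *R (hookProd l *R hookProd r)

rhs : ℕ → RatFun
rhs n = ((ℕ→ℚ (2 ℕ.^ n) ·P zP) *P ((constP (ℕ→ℚ n) +P zP) ^P (n ℕ.∸ 1)))
        ⁄ constP (ℕ→ℚ (n ℕ.!))

-- Write P n for the sum of the hook products over B(n). Splitting a tree at
-- its root gives  P (m+1) = H (m+1) · Σ_k P k · P (m-k),  where H h is the hook
-- factor of a root of hook length h. With the Abel polynomials
-- A k x = x (x+k)^(k-1) / k!  the claim reads  P n = 2^n A n z.  Abel's identity
-- Σ_k A k x · A (m-k) y = A m (x+y)  (both sides have the same derivative in z
-- by induction, and they agree at one point) turns the convolution into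
-- 2^m A m (2z), and  H (m+1) · 2^m A m (2z) = 2^(m+1) A (m+1) z  is a direct
-- computation. The computations take place in ℚ[z] (coefficient lists up to
-- trailing zeros) and among fractions whose denominators are non-zero-divisors,
-- where cross-multiplication is transitive.

module Submission where

open import Defs
open import Algebra.Bundles using (Semiring; CommutativeSemiring)
open import Algebra.Structures using (IsCommutativeSemiring)
open import Algebra.Structures.Biased using (IsCommutativeSemiringˡ; IsCommutativeMonoidˡ)
import Algebra.Properties.CommutativeSemigroup as CommutativeSemigroupProperties
import Algebra.Properties.Group as GroupProperties
open import Data.Empty using (⊥)
open import Data.Integer as ℤ using (+_)
open import Data.Integer.Solver using () renaming (module +-*-Solver to ℤSolver)
open import Data.List using (List; []; _∷_; _++_; map; foldr; cartesianProductWith)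
open import Data.List.Properties using (map-++; map-∘)
open import Data.List.Membership.Propositional using (_∈_)
import Data.List.Membership.Propositional.Properties as Membership
open import Data.List.Membership.Propositional.Properties.WithK using (unique∧set⇒bag)
open import Data.List.Relation.Binary.BagAndSetEquality using (∼bag⇒↭)
open import Data.List.Relation.Binary.Permutation.Propositional using (_↭_; ↭⇒↭ₛ′)
import Data.List.Relation.Binary.Permutation.Propositional.Properties as Perm
open import Data.List.Relation.Binary.Permutation.Setoid.Properties using (foldr-commMonoid)
open import Data.List.Relation.Unary.All as All using (All; []; _∷_)
import Data.List.Relation.Unary.All.Properties as All
open import Data.List.Relation.Unary.AllPairs using ([]; _∷_)
open import Data.List.Relation.Unary.Any using (here)
open import Data.List.Relation.Unary.Unique.Propositional using (Unique)
import Data.List.Relation.Unary.Unique.Propositional.Properties as Unique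
open import Data.Maybe using (nothing)
open import Data.Nat as ℕ using (ℕ; zero; suc; _≤_; z≤n; s≤s; _!; _^_)
import Data.Nat.Properties as ℕP
open import Data.Nat.Coprimality using (1-coprimeTo) renaming (sym to coprime-sym)
open import Data.Product using (_×_; _,_)
open import Data.Rational as ℚ using (ℚ; 0ℚ; 1ℚ; mkℚ)
import Data.Rational.Properties as ℚP
open import Data.Rational.Solver using (module +-*-Solver)
import Data.Rational.Unnormalised as ℚᵘ
import Data.Rational.Unnormalised.Properties as ℚᵘP
open import Data.Sum using (_⊎_; inj₁; inj₂)
open import Function.Bundles using (mk⇔)
open import Relation.Binary.Bundles using (Setoid)
open import Relation.Binary.Structures using (IsEquivalence)
open import Relation.Binary.PropositionalEquality as ≡ using (_≡_; _≢_; refl; sym; trans; cong; cong₂; subst)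
import Relation.Binary.Reasoning.Setoid as SetoidReasoning
open import Tactic.RingSolver.Core.AlmostCommutativeRing using (fromCommutativeSemiring)
import Tactic.RingSolver.NonReflective as NonReflective

cauchy : ∀ {a} {A : Set a} → (A → A → A) → (A → A → A) → (ℕ → A) → (ℕ → A) → ℕ → A
cauchy _⊕_ _⊗_ f g zero    = f 0 ⊗ g 0
cauchy _⊕_ _⊗_ f g (suc m) = (f 0 ⊗ g (suc m)) ⊕ cauchy _⊕_ _⊗_ (λ k → f (suc k)) g m

module SemiringSums {c ℓ} (R : Semiring c ℓ) where
  open Semiring R renaming (refl to ≈-refl; sym to ≈-sym; trans to ≈-trans; reflexive to ≈-reflexive)
  open SetoidReasoning setoid

  sum : List Carrier → Carrier
  sum = foldr _+_ 0#

  sum-++ : ∀ xs ys → sum (xs ++ ys) ≈ sum xs + sum ys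
  sum-++ []       ys = ≈-sym (+-identityˡ (sum ys))
  sum-++ (x ∷ xs) ys = ≈-trans (+-congˡ (sum-++ xs ys)) (≈-sym (+-assoc x (sum xs) (sum ys)))

  sum-map-*ˡ : ∀ {A : Set} (a : Carrier) (f : A → Carrier) xs →
               sum (map (λ x → a * f x) xs) ≈ a * sum (map f xs)
  sum-map-*ˡ a f []       = ≈-sym (zeroʳ a)
  sum-map-*ˡ a f (x ∷ xs) = ≈-trans (+-congˡ (sum-map-*ˡ a f xs)) (≈-sym (distribˡ a (f x) (sum (map f xs))))

  sum-map-cong : ∀ {A : Set} {f g : A → Carrier} → (∀ x → f x ≈ g x) → ∀ xs →
                 sum (map f xs) ≈ sum (map g xs)
  sum-map-cong f≈g []       = ≈-refl
  sum-map-cong f≈g (x ∷ xs) = +-cong (f≈g x) (sum-map-cong f≈g xs)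

  sum-cartesianProductWith : ∀ {A B C : Set} (f : A → B → C) (w : C → Carrier)
    (u : A → Carrier) (v : B → Carrier) → (∀ a b → w (f a b) ≈ u a * v b) →
    ∀ as bs → sum (map w (cartesianProductWith f as bs)) ≈ sum (map u as) * sum (map v bs)
  sum-cartesianProductWith f w u v w≈uv []       bs = ≈-sym (zeroˡ (sum (map v bs)))
  sum-cartesianProductWith f w u v w≈uv (a ∷ as) bs = begin
    sum (map w (map (f a) bs ++ cartesianProductWith f as bs))
      ≡⟨ cong sum (map-++ w (map (f a) bs) _) ⟩
    sum (map w (map (f a) bs) ++ map w (cartesianProductWith f as bs))
      ≈⟨ sum-++ (map w (map (f a) bs)) _ ⟩
    sum (map w (map (f a) bs)) + sum (map w (cartesianProductWith f as bs))
      ≈⟨ +-cong (≈-reflexive (cong sum (sym (map-∘ bs)))) (sum-cartesianProductWith f w u v w≈uv as bs) ⟩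
    sum (map (λ b → w (f a b)) bs) + sum (map u as) * sum (map v bs)
      ≈⟨ +-congʳ (≈-trans (sum-map-cong (w≈uv a) bs) (sum-map-*ˡ (u a) v bs)) ⟩
    u a * sum (map v bs) + sum (map u as) * sum (map v bs)
      ≈⟨ distribʳ (sum (map v bs)) (u a) (sum (map u as)) ⟨
    (u a + sum (map u as)) * sum (map v bs)
      ∎

module CauchyProperties {c ℓ} (R : CommutativeSemiring c ℓ) where
  open CommutativeSemiring R renaming (refl to ≈-refl; sym to ≈-sym; trans to ≈-trans; reflexive to ≈-reflexive)
  open CommutativeSemigroupProperties *-commutativeSemigroup using (interchange)
  open SetoidReasoning setoid

  conv : (ℕ → Carrier) → (ℕ → Carrier) → ℕ → Carrier
  conv = cauchy _+_ _*_

  conv-cong : ∀ {f f′ g g′} m → (∀ k → k ℕ.≤ m → f k ≈ f′ k) → (∀ k → k ℕ.≤ m → g k ≈ g′ k) →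
              conv f g m ≈ conv f′ g′ m
  conv-cong zero    f≈ g≈ = *-cong (f≈ 0 ℕ.z≤n) (g≈ 0 ℕ.z≤n)
  conv-cong (suc m) f≈ g≈ = +-cong (*-cong (f≈ 0 ℕ.z≤n) (g≈ (suc m) ℕP.≤-refl))
    (conv-cong m (λ k k≤m → f≈ (suc k) (ℕ.s≤s k≤m)) (λ k k≤m → g≈ k (ℕP.m≤n⇒m≤1+n k≤m)))

  conv-shiftˡ : ∀ f g m → f 0 ≈ 0# → conv f g (suc m) ≈ conv (λ k → f (suc k)) g m
  conv-shiftˡ f g m f0≈0 = ≈-trans (+-congʳ (≈-trans (*-congʳ f0≈0) (zeroˡ (g (suc m))))) (+-identityˡ _)

  conv-shiftʳ : ∀ f g m → g 0 ≈ 0# → conv f g (suc m) ≈ conv f (λ k → g (suc k)) m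
  conv-shiftʳ f g zero    g0≈0 = ≈-trans (+-congˡ (≈-trans (*-congˡ g0≈0) (zeroʳ (f 1)))) (+-identityʳ _)
  conv-shiftʳ f g (suc m) g0≈0 = +-congˡ (conv-shiftʳ (λ k → f (suc k)) g m g0≈0)

  conv-weighted : ∀ (e : ℕ → Carrier) → (∀ i j → e (i ℕ.+ j) ≈ e i * e j) →
    ∀ a f g m → conv (λ k → e (a ℕ.+ k) * f k) (λ k → e k * g k) m ≈ e (a ℕ.+ m) * conv f g m
  conv-weighted e e-hom a f g zero = begin
    (e (a ℕ.+ 0) * f 0) * (e 0 * g 0)    ≈⟨ interchange (e (a ℕ.+ 0)) (f 0) (e 0) (g 0) ⟩
    (e (a ℕ.+ 0) * e 0) * (f 0 * g 0)    ≈⟨ *-congʳ (e-hom (a ℕ.+ 0) 0) ⟨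
    e ((a ℕ.+ 0) ℕ.+ 0) * (f 0 * g 0)    ≡⟨ cong (λ n → e n * (f 0 * g 0)) (ℕP.+-identityʳ (a ℕ.+ 0)) ⟩
    e (a ℕ.+ 0) * (f 0 * g 0)            ∎
  conv-weighted e e-hom a f g (suc m) = begin
    (e (a ℕ.+ 0) * f 0) * (e (suc m) * g (suc m)) + conv (λ k → e (a ℕ.+ suc k) * f (suc k)) (λ k → e k * g k) m
      ≈⟨ +-cong (interchange (e (a ℕ.+ 0)) (f 0) (e (suc m)) (g (suc m)))
                (conv-cong m (λ k _ → ≈-reflexive (cong (λ n → e n * f (suc k)) (ℕP.+-suc a k))) (λ k _ → ≈-refl)) ⟩
    (e (a ℕ.+ 0) * e (suc m)) * (f 0 * g (suc m)) + conv (λ k → e (suc a ℕ.+ k) * f (suc k)) (λ k → e k * g k) m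
      ≈⟨ +-cong (*-congʳ (≈-trans (≈-sym (e-hom (a ℕ.+ 0) (suc m))) (≈-reflexive (cong (λ n → e (n ℕ.+ suc m)) (ℕP.+-identityʳ a)))))
                (≈-trans (conv-weighted e e-hom (suc a) (λ k → f (suc k)) g m) (*-congʳ (≈-reflexive (cong e (sym (ℕP.+-suc a m)))))) ⟩
    e (a ℕ.+ suc m) * (f 0 * g (suc m)) + e (a ℕ.+ suc m) * conv (λ k → f (suc k)) g m
      ≈⟨ distribˡ (e (a ℕ.+ suc m)) (f 0 * g (suc m)) _ ⟨
    e (a ℕ.+ suc m) * conv f g (suc m)
      ∎

  conv-homomorphic : ∀ {a} {A : Set a} (_⊕_ _⊗_ : A → A → A) (h k : A → Carrier) →
    (∀ x y → h (x ⊕ y) ≈ h x + h y) → (∀ x y → h (x ⊗ y) ≈ k x * k y) →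
    ∀ f g m → h (cauchy _⊕_ _⊗_ f g m) ≈ conv (λ i → k (f i)) (λ i → k (g i)) m
  conv-homomorphic _⊕_ _⊗_ h k h-⊕ h-⊗ f g zero    = h-⊗ (f 0) (g 0)
  conv-homomorphic _⊕_ _⊗_ h k h-⊕ h-⊗ f g (suc m) =
    ≈-trans (h-⊕ _ _) (+-cong (h-⊗ (f 0) (g (suc m))) (conv-homomorphic _⊕_ _⊗_ h k h-⊕ h-⊗ (λ i → f (suc i)) g m))

ℕ→ℚ≡mkℚ : ∀ n → ℕ→ℚ n ≡ mkℚ (+ n) 0 (coprime-sym (1-coprimeTo n))
ℕ→ℚ≡mkℚ n = ℚP.normalize-coprime (coprime-sym (1-coprimeTo n))

ℕ→ℚ-suc : ∀ n → ℕ→ℚ (suc n) ≡ 1ℚ ℚ.+ ℕ→ℚ n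
ℕ→ℚ-suc n rewrite ℕ→ℚ≡mkℚ (suc n) | ℕ→ℚ≡mkℚ n =
  ℚP.toℚᵘ-injective (ℚᵘP.≃-trans (ℚᵘ.*≡* (integer-identity (+ n)))
                                 (ℚᵘP.≃-sym (ℚP.toℚᵘ-homo-+ 1ℚ (mkℚ (+ n) 0 (coprime-sym (1-coprimeTo n))))))
  where
  open ℤSolver
  integer-identity : ∀ x → (+ 1 ℤ.+ x) ℤ.* + 1 ≡ (+ 1 ℤ.* + 1 ℤ.+ x ℤ.* + 1) ℤ.* + 1
  integer-identity = solve 1 (λ x → (con (+ 1) :+ x) :* con (+ 1) := (con (+ 1) :* con (+ 1) :+ x :* con (+ 1)) :* con (+ 1)) refl

ℕ→ℚ-+ : ∀ m n → ℕ→ℚ (m ℕ.+ n) ≡ ℕ→ℚ m ℚ.+ ℕ→ℚ n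
ℕ→ℚ-+ zero    n = sym (ℚP.+-identityˡ (ℕ→ℚ n))
ℕ→ℚ-+ (suc m) n = begin
  ℕ→ℚ (suc (m ℕ.+ n))            ≡⟨ ℕ→ℚ-suc (m ℕ.+ n) ⟩
  1ℚ ℚ.+ ℕ→ℚ (m ℕ.+ n)           ≡⟨ cong (1ℚ ℚ.+_) (ℕ→ℚ-+ m n) ⟩
  1ℚ ℚ.+ (ℕ→ℚ m ℚ.+ ℕ→ℚ n)       ≡⟨ ℚP.+-assoc 1ℚ (ℕ→ℚ m) (ℕ→ℚ n) ⟨
  (1ℚ ℚ.+ ℕ→ℚ m) ℚ.+ ℕ→ℚ n       ≡⟨ cong (ℚ._+ ℕ→ℚ n) (ℕ→ℚ-suc m) ⟨
  ℕ→ℚ (suc m) ℚ.+ ℕ→ℚ n          ∎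
  where open ≡.≡-Reasoning

ℕ→ℚ-* : ∀ m n → ℕ→ℚ (m ℕ.* n) ≡ ℕ→ℚ m ℚ.* ℕ→ℚ n
ℕ→ℚ-* zero    n = sym (ℚP.*-zeroˡ (ℕ→ℚ n))
ℕ→ℚ-* (suc m) n = begin
  ℕ→ℚ (n ℕ.+ m ℕ.* n)            ≡⟨ ℕ→ℚ-+ n (m ℕ.* n) ⟩
  ℕ→ℚ n ℚ.+ ℕ→ℚ (m ℕ.* n)        ≡⟨ cong (ℕ→ℚ n ℚ.+_) (ℕ→ℚ-* m n) ⟩
  ℕ→ℚ n ℚ.+ ℕ→ℚ m ℚ.* ℕ→ℚ n      ≡⟨ one-plus-times (ℕ→ℚ m) (ℕ→ℚ n) ⟨
  (1ℚ ℚ.+ ℕ→ℚ m) ℚ.* ℕ→ℚ n       ≡⟨ cong (ℚ._* ℕ→ℚ n) (ℕ→ℚ-suc m) ⟨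
  ℕ→ℚ (suc m) ℚ.* ℕ→ℚ n          ∎
  where
  open ≡.≡-Reasoning
  open +-*-Solver
  one-plus-times : ∀ x y → (1ℚ ℚ.+ x) ℚ.* y ≡ y ℚ.+ x ℚ.* y
  one-plus-times = solve 2 (λ x y → (con 1ℚ :+ x) :* y := y :+ x :* y) refl

ℕ→ℚ-suc-nonZero : ∀ n → ℚ.NonZero (ℕ→ℚ (suc n))
ℕ→ℚ-suc-nonZero n rewrite ℕ→ℚ≡mkℚ (suc n) = _

ℕ→ℚ-suc≢0 : ∀ n → ℕ→ℚ (suc n) ≢ 0ℚ
ℕ→ℚ-suc≢0 n rewrite ℕ→ℚ≡mkℚ (suc n) = λ ()

*-cancelʳ-≢0 : ∀ {x y c} → c ≢ 0ℚ → x ℚ.* c ≡ y ℚ.* c → x ≡ y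
*-cancelʳ-≢0 {x} {y} {c} c≢0 eq = begin
  x                          ≡⟨ ℚP.*-identityʳ x ⟨
  x ℚ.* 1ℚ                   ≡⟨ cong (x ℚ.*_) (ℚP.*-inverseʳ c) ⟨
  x ℚ.* (c ℚ.* ℚ.1/ c)       ≡⟨ ℚP.*-assoc x c (ℚ.1/ c) ⟨
  (x ℚ.* c) ℚ.* ℚ.1/ c       ≡⟨ cong (ℚ._* ℚ.1/ c) eq ⟩
  (y ℚ.* c) ℚ.* ℚ.1/ c       ≡⟨ ℚP.*-assoc y c (ℚ.1/ c) ⟩
  y ℚ.* (c ℚ.* ℚ.1/ c)       ≡⟨ cong (y ℚ.*_) (ℚP.*-inverseʳ c) ⟩
  y ℚ.* 1ℚ                   ≡⟨ ℚP.*-identityʳ y ⟩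
  y                          ∎
  where
  open ≡.≡-Reasoning
  instance
    c-nonZero : ℚ.NonZero c
    c-nonZero = ℚ.≢-nonZero c≢0

*-cancelˡ-≢0 : ∀ {x y c} → c ≢ 0ℚ → c ℚ.* x ≡ c ℚ.* y → x ≡ y
*-cancelˡ-≢0 {x} {y} {c} c≢0 eq =
  *-cancelʳ-≢0 c≢0 (trans (ℚP.*-comm x c) (trans eq (ℚP.*-comm c y)))

open GroupProperties ℚP.+-0-group using () renaming (∙-cancelʳ to +-cancelʳ)

-- The polynomial semiring ℚ[z]

coeff : ℕ → Poly → ℚ
coeff i       []      = 0ℚ
coeff zero    (a ∷ p) = a
coeff (suc i) (a ∷ p) = coeff i p

infix 4 _≋_
record _≋_ (p q : Poly) : Set where
  constructor mk≋
  field coeff-≡ : ∀ i → coeff i p ≡ coeff i q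
open _≋_

≋-refl : ∀ {p} → p ≋ p
≋-refl = mk≋ λ i → refl

≋-sym : ∀ {p q} → p ≋ q → q ≋ p
≋-sym e = mk≋ λ i → sym (coeff-≡ e i)

≋-trans : ∀ {p q r} → p ≋ q → q ≋ r → p ≋ r
≋-trans e f = mk≋ λ i → trans (coeff-≡ e i) (coeff-≡ f i)

≡⇒≋ : ∀ {p q} → p ≡ q → p ≋ q
≡⇒≋ refl = ≋-refl

≋-isEquivalence : IsEquivalence _≋_
≋-isEquivalence = record { refl = ≋-refl ; sym = ≋-sym ; trans = ≋-trans }

≋-setoid : Setoid _ _
≋-setoid = record { isEquivalence = ≋-isEquivalence }

module ≋-Reasoning = SetoidReasoning ≋-setoid

∷-cong : ∀ {a b p q} → a ≡ b → p ≋ q → (a ∷ p) ≋ (b ∷ q)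
∷-cong a≡b p≋q = mk≋ λ { zero → a≡b ; (suc i) → coeff-≡ p≋q i }

∷-injective : ∀ {a b p q} → (a ∷ p) ≋ (b ∷ q) → a ≡ b × p ≋ q
∷-injective e = coeff-≡ e zero , mk≋ λ i → coeff-≡ e (suc i)

[0]≋[] : (0ℚ ∷ []) ≋ []
[0]≋[] = mk≋ λ { zero → refl ; (suc i) → refl }

coeff-+ : ∀ i p q → coeff i (p +P q) ≡ coeff i p ℚ.+ coeff i q
coeff-+ i       []      q       = sym (ℚP.+-identityˡ (coeff i q))
coeff-+ i       (a ∷ p) []      = sym (ℚP.+-identityʳ (coeff i (a ∷ p)))
coeff-+ zero    (a ∷ p) (b ∷ q) = refl
coeff-+ (suc i) (a ∷ p) (b ∷ q) = coeff-+ i p q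

coeff-· : ∀ i c p → coeff i (c ·P p) ≡ c ℚ.* coeff i p
coeff-· i       c []      = sym (ℚP.*-zeroʳ c)
coeff-· zero    c (a ∷ p) = refl
coeff-· (suc i) c (a ∷ p) = coeff-· i c p

+P-cong : ∀ {p p′ q q′} → p ≋ p′ → q ≋ q′ → p +P q ≋ p′ +P q′
+P-cong {p} {p′} {q} {q′} e f = mk≋ λ i →
  trans (coeff-+ i p q) (trans (cong₂ ℚ._+_ (coeff-≡ e i) (coeff-≡ f i)) (sym (coeff-+ i p′ q′)))

+P-comm : ∀ p q → p +P q ≋ q +P p
+P-comm p q = mk≋ λ i →
  trans (coeff-+ i p q) (trans (ℚP.+-comm (coeff i p) (coeff i q)) (sym (coeff-+ i q p)))

+P-assoc : ∀ p q r → (p +P q) +P r ≋ p +P (q +P r)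
+P-assoc p q r = mk≋ λ i → begin
  coeff i ((p +P q) +P r)                  ≡⟨ coeff-+ i (p +P q) r ⟩
  coeff i (p +P q) ℚ.+ coeff i r           ≡⟨ cong (ℚ._+ coeff i r) (coeff-+ i p q) ⟩
  (coeff i p ℚ.+ coeff i q) ℚ.+ coeff i r  ≡⟨ ℚP.+-assoc (coeff i p) (coeff i q) (coeff i r) ⟩
  coeff i p ℚ.+ (coeff i q ℚ.+ coeff i r)  ≡⟨ cong (coeff i p ℚ.+_) (coeff-+ i q r) ⟨
  coeff i p ℚ.+ coeff i (q +P r)           ≡⟨ coeff-+ i p (q +P r) ⟨
  coeff i (p +P (q +P r))                  ∎
  where open ≡.≡-Reasoning

+P-identityʳ : ∀ p → p +P [] ≋ p
+P-identityʳ p = mk≋ λ i → trans (coeff-+ i p []) (ℚP.+-identityʳ (coeff i p))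

+P-interchange : ∀ p q r s → (p +P q) +P (r +P s) ≋ (p +P r) +P (q +P s)
+P-interchange p q r s = begin
  (p +P q) +P (r +P s)  ≈⟨ +P-assoc p q (r +P s) ⟩
  p +P (q +P (r +P s))  ≈⟨ +P-cong (≋-refl {p}) (≋-sym (+P-assoc q r s)) ⟩
  p +P ((q +P r) +P s)  ≈⟨ +P-cong (≋-refl {p}) (+P-cong (+P-comm q r) (≋-refl {s})) ⟩
  p +P ((r +P q) +P s)  ≈⟨ +P-cong (≋-refl {p}) (+P-assoc r q s) ⟩
  p +P (r +P (q +P s))  ≈⟨ +P-assoc p r (q +P s) ⟨
  (p +P r) +P (q +P s)  ∎
  where open ≋-Reasoning

·P-cong : ∀ {c d p q} → c ≡ d → p ≋ q → c ·P p ≋ d ·P q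
·P-cong {c} {d} {p} {q} c≡d e = mk≋ λ i →
  trans (coeff-· i c p) (trans (cong₂ ℚ._*_ c≡d (coeff-≡ e i)) (sym (coeff-· i d q)))

·P-distribˡ : ∀ c p q → c ·P (p +P q) ≋ c ·P p +P c ·P q
·P-distribˡ c p q = mk≋ λ i → begin
  coeff i (c ·P (p +P q))                  ≡⟨ coeff-· i c (p +P q) ⟩
  c ℚ.* coeff i (p +P q)                   ≡⟨ cong (c ℚ.*_) (coeff-+ i p q) ⟩
  c ℚ.* (coeff i p ℚ.+ coeff i q)          ≡⟨ ℚP.*-distribˡ-+ c (coeff i p) (coeff i q) ⟩
  c ℚ.* coeff i p ℚ.+ c ℚ.* coeff i q      ≡⟨ cong₂ ℚ._+_ (coeff-· i c p) (coeff-· i c q) ⟨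
  coeff i (c ·P p) ℚ.+ coeff i (c ·P q)    ≡⟨ coeff-+ i (c ·P p) (c ·P q) ⟨
  coeff i (c ·P p +P c ·P q)               ∎
  where open ≡.≡-Reasoning

·P-distribʳ : ∀ c d p → (c ℚ.+ d) ·P p ≋ c ·P p +P d ·P p
·P-distribʳ c d p = mk≋ λ i → begin
  coeff i ((c ℚ.+ d) ·P p)                 ≡⟨ coeff-· i (c ℚ.+ d) p ⟩
  (c ℚ.+ d) ℚ.* coeff i p                  ≡⟨ ℚP.*-distribʳ-+ (coeff i p) c d ⟩
  c ℚ.* coeff i p ℚ.+ d ℚ.* coeff i p      ≡⟨ cong₂ ℚ._+_ (coeff-· i c p) (coeff-· i d p) ⟨
  coeff i (c ·P p) ℚ.+ coeff i (d ·P p)    ≡⟨ coeff-+ i (c ·P p) (d ·P p) ⟨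
  coeff i (c ·P p +P d ·P p)               ∎
  where open ≡.≡-Reasoning

·P-assoc : ∀ c d p → c ·P (d ·P p) ≋ (c ℚ.* d) ·P p
·P-assoc c d p = mk≋ λ i →
  trans (coeff-· i c (d ·P p)) (trans (cong (c ℚ.*_) (coeff-· i d p))
    (trans (sym (ℚP.*-assoc c d (coeff i p))) (sym (coeff-· i (c ℚ.* d) p))))

·P-identity : ∀ p → 1ℚ ·P p ≋ p
·P-identity p = mk≋ λ i → trans (coeff-· i 1ℚ p) (ℚP.*-identityˡ (coeff i p))

·P-zero : ∀ p → 0ℚ ·P p ≋ []
·P-zero p = mk≋ λ i → trans (coeff-· i 0ℚ p) (ℚP.*-zeroˡ (coeff i p))

shift : Poly → Poly
shift p = 0ℚ ∷ p

shift-cong : ∀ {p q} → p ≋ q → shift p ≋ shift q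
shift-cong = ∷-cong refl

shift-+ : ∀ p q → shift (p +P q) ≋ shift p +P shift q
shift-+ p q = ∷-cong (sym (ℚP.+-identityˡ 0ℚ)) ≋-refl

·P-shift : ∀ c p → c ·P shift p ≋ shift (c ·P p)
·P-shift c p = ∷-cong (ℚP.*-zeroʳ c) ≋-refl

*P-congʳ : ∀ p {q q′} → q ≋ q′ → p *P q ≋ p *P q′
*P-congʳ []      e = ≋-refl
*P-congʳ (a ∷ p) e = +P-cong (·P-cong refl e) (shift-cong (*P-congʳ p e))

*P-zeroʳ : ∀ p → p *P [] ≋ []
*P-zeroʳ []      = ≋-refl
*P-zeroʳ (a ∷ p) = ≋-trans (shift-cong (*P-zeroʳ p)) [0]≋[]

*P-∷ : ∀ q a p → q *P (a ∷ p) ≋ a ·P q +P shift (q *P p)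
*P-∷ []      a p = ≋-sym [0]≋[]
*P-∷ (b ∷ q) a p = begin
  b ·P (a ∷ p) +P shift (q *P (a ∷ p))
    ≈⟨ +P-cong (≋-refl {b ·P (a ∷ p)}) (shift-cong (*P-∷ q a p)) ⟩
  ((b ℚ.* a) ∷ b ·P p) +P shift (a ·P q +P shift (q *P p))
    ≈⟨ ∷-cong (cong (ℚ._+ 0ℚ) (ℚP.*-comm b a)) (begin
         b ·P p +P (a ·P q +P shift (q *P p))   ≈⟨ +P-assoc (b ·P p) (a ·P q) (shift (q *P p)) ⟨
         (b ·P p +P a ·P q) +P shift (q *P p)   ≈⟨ +P-cong (+P-comm (b ·P p) (a ·P q)) ≋-refl ⟩
         (a ·P q +P b ·P p) +P shift (q *P p)   ≈⟨ +P-assoc (a ·P q) (b ·P p) (shift (q *P p)) ⟩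
         a ·P q +P (b ·P p +P shift (q *P p))   ∎) ⟩
  ((a ℚ.* b) ℚ.+ 0ℚ) ∷ (a ·P q +P (b ·P p +P shift (q *P p)))
    ∎
  where open ≋-Reasoning

*P-comm : ∀ p q → p *P q ≋ q *P p
*P-comm []      q = ≋-sym (*P-zeroʳ q)
*P-comm (a ∷ p) q = ≋-trans (+P-cong ≋-refl (shift-cong (*P-comm p q))) (≋-sym (*P-∷ q a p))

*P-congˡ : ∀ {p p′} q → p ≋ p′ → p *P q ≋ p′ *P q
*P-congˡ {p} {p′} q e = ≋-trans (*P-comm p q) (≋-trans (*P-congʳ q e) (*P-comm q p′))

*P-cong : ∀ {p p′ q q′} → p ≋ p′ → q ≋ q′ → p *P q ≋ p′ *P q′
*P-cong {p′ = p′} {q = q} e f = ≋-trans (*P-congˡ q e) (*P-congʳ p′ f)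

*P-distribʳ : ∀ r p q → (p +P q) *P r ≋ p *P r +P q *P r
*P-distribʳ r []      q       = ≋-refl
*P-distribʳ r (a ∷ p) []      = ≋-sym (+P-identityʳ _)
*P-distribʳ r (a ∷ p) (b ∷ q) = begin
  (a ℚ.+ b) ·P r +P shift ((p +P q) *P r)
    ≈⟨ +P-cong (·P-distribʳ a b r) (≋-trans (shift-cong (*P-distribʳ r p q)) (shift-+ (p *P r) (q *P r))) ⟩
  (a ·P r +P b ·P r) +P (shift (p *P r) +P shift (q *P r))
    ≈⟨ +P-interchange (a ·P r) (b ·P r) (shift (p *P r)) (shift (q *P r)) ⟩
  (a ·P r +P shift (p *P r)) +P (b ·P r +P shift (q *P r))
    ∎
  where open ≋-Reasoning

·P-*P : ∀ c p q → (c ·P p) *P q ≋ c ·P (p *P q)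
·P-*P c []      q = ≋-refl
·P-*P c (a ∷ p) q = begin
  (c ℚ.* a) ·P q +P shift ((c ·P p) *P q)   ≈⟨ +P-cong (≋-sym (·P-assoc c a q)) (shift-cong (·P-*P c p q)) ⟩
  c ·P (a ·P q) +P shift (c ·P (p *P q))    ≈⟨ +P-cong (≋-refl {c ·P (a ·P q)}) (≋-sym (·P-shift c (p *P q))) ⟩
  c ·P (a ·P q) +P c ·P shift (p *P q)      ≈⟨ ·P-distribˡ c (a ·P q) (shift (p *P q)) ⟨
  c ·P (a ·P q +P shift (p *P q))           ∎
  where open ≋-Reasoning

*P-assoc : ∀ p q r → (p *P q) *P r ≋ p *P (q *P r)
*P-assoc []      q r = ≋-refl
*P-assoc (a ∷ p) q r = begin
  (a ·P q +P shift (p *P q)) *P r         ≈⟨ *P-distribʳ r (a ·P q) (shift (p *P q)) ⟩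
  (a ·P q) *P r +P shift (p *P q) *P r    ≈⟨ +P-cong (·P-*P a q r) (+P-cong (·P-zero r) (shift-cong (*P-assoc p q r))) ⟩
  a ·P (q *P r) +P shift (p *P (q *P r))  ∎
  where open ≋-Reasoning

1P : Poly
1P = constP 1ℚ

constP-*P : ∀ c p → constP c *P p ≋ c ·P p
constP-*P c p = ≋-trans (+P-cong (≋-refl {c ·P p}) [0]≋[]) (+P-identityʳ (c ·P p))

*P-identityˡ : ∀ p → 1P *P p ≋ p
*P-identityˡ p = ≋-trans (constP-*P 1ℚ p) (·P-identity p)

*P-identityʳ : ∀ p → p *P 1P ≋ p
*P-identityʳ p = ≋-trans (*P-comm p 1P) (*P-identityˡ p)

Poly-isCommutativeSemiring : IsCommutativeSemiring _≋_ _+P_ _*P_ [] 1P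
Poly-isCommutativeSemiring = IsCommutativeSemiringˡ.isCommutativeSemiring record
  { +-isCommutativeMonoid = record
    { isMonoid = record
      { isSemigroup = record
        { isMagma = record { isEquivalence = ≋-isEquivalence ; ∙-cong = +P-cong }
        ; assoc = +P-assoc }
      ; identity = (λ p → ≋-refl) , +P-identityʳ }
    ; comm = +P-comm }
  ; *-isCommutativeMonoid = record
    { isMonoid = record
      { isSemigroup = record
        { isMagma = record { isEquivalence = ≋-isEquivalence ; ∙-cong = *P-cong }
        ; assoc = *P-assoc }
      ; identity = *P-identityˡ , *P-identityʳ }
    ; comm = *P-comm }
  ; distribʳ = *P-distribʳ
  ; zeroˡ = λ p → ≋-refl
  }

Poly-commutativeSemiring : CommutativeSemiring _ _
Poly-commutativeSemiring = record { isCommutativeSemiring = Poly-isCommutativeSemiring }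

module PolySolver = NonReflective (fromCommutativeSemiring Poly-commutativeSemiring (λ _ → nothing))
open PolySolver using (_⊕_; _⊗_; _⊜_; Κ)

ℕ→P : ℕ → Poly
ℕ→P n = constP (ℕ→ℚ n)

ℕ→P-suc : ∀ n → ℕ→P (suc n) ≋ 1P +P ℕ→P n
ℕ→P-suc n = ≡⇒≋ (cong constP (ℕ→ℚ-suc n))

^P-cong : ∀ {p q} n → p ≋ q → p ^P n ≋ q ^P n
^P-cong zero    e = ≋-refl
^P-cong (suc n) e = *P-cong e (^P-cong n e)

^P-+ : ∀ p m n → p ^P (m ℕ.+ n) ≋ p ^P m *P p ^P n
^P-+ p zero    n = ≋-sym (*P-identityˡ (p ^P n))
^P-+ p (suc m) n = ≋-trans (*P-congʳ p (^P-+ p m n)) (≋-sym (*P-assoc p (p ^P m) (p ^P n)))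

-- Evaluation and the formal derivative

eval : Poly → ℚ → ℚ
eval []      w = 0ℚ
eval (a ∷ p) w = a ℚ.+ w ℚ.* eval p w

eval-+ : ∀ p q w → eval (p +P q) w ≡ eval p w ℚ.+ eval q w
eval-+ []      q       w = sym (ℚP.+-identityˡ (eval q w))
eval-+ (a ∷ p) []      w = sym (ℚP.+-identityʳ (eval (a ∷ p) w))
eval-+ (a ∷ p) (b ∷ q) w =
  trans (cong (λ t → (a ℚ.+ b) ℚ.+ w ℚ.* t) (eval-+ p q w)) (regroup a b w (eval p w) (eval q w))
  where
  open +-*-Solver
  regroup : ∀ a b w x y → (a ℚ.+ b) ℚ.+ w ℚ.* (x ℚ.+ y) ≡ (a ℚ.+ w ℚ.* x) ℚ.+ (b ℚ.+ w ℚ.* y)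
  regroup = solve 5 (λ a b w x y → (a :+ b) :+ w :* (x :+ y) := (a :+ w :* x) :+ (b :+ w :* y)) refl

eval-· : ∀ c p w → eval (c ·P p) w ≡ c ℚ.* eval p w
eval-· c []      w = sym (ℚP.*-zeroʳ c)
eval-· c (a ∷ p) w = trans (cong (λ t → c ℚ.* a ℚ.+ w ℚ.* t) (eval-· c p w)) (regroup c a w (eval p w))
  where
  open +-*-Solver
  regroup : ∀ c a w x → c ℚ.* a ℚ.+ w ℚ.* (c ℚ.* x) ≡ c ℚ.* (a ℚ.+ w ℚ.* x)
  regroup = solve 4 (λ c a w x → c :* a :+ w :* (c :* x) := c :* (a :+ w :* x)) refl

eval-* : ∀ p q w → eval (p *P q) w ≡ eval p w ℚ.* eval q w
eval-* []      q w = sym (ℚP.*-zeroˡ (eval q w))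
eval-* (a ∷ p) q w = begin
  eval (a ·P q +P shift (p *P q)) w                    ≡⟨ eval-+ (a ·P q) (shift (p *P q)) w ⟩
  eval (a ·P q) w ℚ.+ (0ℚ ℚ.+ w ℚ.* eval (p *P q) w)   ≡⟨ cong₂ (λ s t → s ℚ.+ (0ℚ ℚ.+ w ℚ.* t)) (eval-· a q w) (eval-* p q w) ⟩
  a ℚ.* y ℚ.+ (0ℚ ℚ.+ w ℚ.* (x ℚ.* y))                 ≡⟨ regroup a w x y ⟩
  (a ℚ.+ w ℚ.* x) ℚ.* y                                ∎
  where
  open ≡.≡-Reasoning
  x = eval p w
  y = eval q w
  open +-*-Solver
  regroup : ∀ a w x y → a ℚ.* y ℚ.+ (0ℚ ℚ.+ w ℚ.* (x ℚ.* y)) ≡ (a ℚ.+ w ℚ.* x) ℚ.* y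
  regroup = solve 4 (λ a w x y → a :* y :+ (con 0ℚ :+ w :* (x :* y)) := (a :+ w :* x) :* y) refl

eval-^-cong : ∀ {p q} n w → eval p w ≡ eval q w → eval (p ^P n) w ≡ eval (q ^P n) w
eval-^-cong         zero    w e = refl
eval-^-cong {p} {q} (suc n) w e =
  trans (eval-* p (p ^P n) w) (trans (cong₂ ℚ._*_ e (eval-^-cong n w e)) (sym (eval-* q (q ^P n) w)))

eval-zero : ∀ {p} w → p ≋ [] → eval p w ≡ 0ℚ
eval-zero {[]}    w e = refl
eval-zero {a ∷ p} w e with ∷-injective (≋-trans e (≋-sym [0]≋[]))
... | refl , p≋[] = trans (cong (λ t → 0ℚ ℚ.+ w ℚ.* t) (eval-zero w p≋[]))
                          (trans (ℚP.+-identityˡ (w ℚ.* 0ℚ)) (ℚP.*-zeroʳ w))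

eval-cong : ∀ {p q} w → p ≋ q → eval p w ≡ eval q w
eval-cong {[]}    {q}     w e = sym (eval-zero w (≋-sym e))
eval-cong {a ∷ p} {[]}    w e = eval-zero w e
eval-cong {a ∷ p} {b ∷ q} w e with ∷-injective e
... | refl , p≋q = cong (λ t → a ℚ.+ w ℚ.* t) (eval-cong w p≋q)

eval-const : ∀ c w → eval (constP c) w ≡ c
eval-const c w = trans (cong (c ℚ.+_) (ℚP.*-zeroʳ w)) (ℚP.+-identityʳ c)

eval-z : ∀ w → eval zP w ≡ w
eval-z w = trans (cong (λ t → 0ℚ ℚ.+ w ℚ.* t) (eval-const 1ℚ w))
                 (trans (ℚP.+-identityˡ (w ℚ.* 1ℚ)) (ℚP.*-identityʳ w))

∂ : Poly → Poly
∂ []      = []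
∂ (a ∷ p) = p +P shift (∂ p)

coeff-∂ : ∀ i p → coeff i (∂ p) ≡ ℕ→ℚ (suc i) ℚ.* coeff (suc i) p
coeff-∂ i       []          = sym (ℚP.*-zeroʳ (ℕ→ℚ (suc i)))
coeff-∂ zero    (a ∷ [])    = sym (ℚP.*-zeroʳ 1ℚ)
coeff-∂ zero    (a ∷ b ∷ p) = trans (ℚP.+-identityʳ b) (sym (ℚP.*-identityˡ b))
coeff-∂ (suc i) (a ∷ p)     = begin
  coeff (suc i) (p +P shift (∂ p))                       ≡⟨ coeff-+ (suc i) p (shift (∂ p)) ⟩
  coeff (suc i) p ℚ.+ coeff i (∂ p)                      ≡⟨ cong (coeff (suc i) p ℚ.+_) (coeff-∂ i p) ⟩
  coeff (suc i) p ℚ.+ ℕ→ℚ (suc i) ℚ.* coeff (suc i) p    ≡⟨ one-plus-times (ℕ→ℚ (suc i)) (coeff (suc i) p) ⟨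
  (1ℚ ℚ.+ ℕ→ℚ (suc i)) ℚ.* coeff (suc i) p              ≡⟨ cong (ℚ._* coeff (suc i) p) (ℕ→ℚ-suc (suc i)) ⟨
  ℕ→ℚ (suc (suc i)) ℚ.* coeff (suc i) p                 ∎
  where
  open ≡.≡-Reasoning
  open +-*-Solver
  one-plus-times : ∀ x y → (1ℚ ℚ.+ x) ℚ.* y ≡ y ℚ.+ x ℚ.* y
  one-plus-times = solve 2 (λ x y → (con 1ℚ :+ x) :* y := y :+ x :* y) refl

∂-cong : ∀ {p q} → p ≋ q → ∂ p ≋ ∂ q
∂-cong {p} {q} e = mk≋ λ i →
  trans (coeff-∂ i p) (trans (cong (ℕ→ℚ (suc i) ℚ.*_) (coeff-≡ e (suc i))) (sym (coeff-∂ i q)))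

∂-+ : ∀ p q → ∂ (p +P q) ≋ ∂ p +P ∂ q
∂-+ p q = mk≋ coeffs
  where
  coeffs : ∀ i → coeff i (∂ (p +P q)) ≡ coeff i (∂ p +P ∂ q)
  coeffs i = begin
    coeff i (∂ (p +P q))                                       ≡⟨ coeff-∂ i (p +P q) ⟩
    n ℚ.* coeff (suc i) (p +P q)                               ≡⟨ cong (n ℚ.*_) (coeff-+ (suc i) p q) ⟩
    n ℚ.* (coeff (suc i) p ℚ.+ coeff (suc i) q)                ≡⟨ ℚP.*-distribˡ-+ n (coeff (suc i) p) (coeff (suc i) q) ⟩
    n ℚ.* coeff (suc i) p ℚ.+ n ℚ.* coeff (suc i) q            ≡⟨ cong₂ ℚ._+_ (coeff-∂ i p) (coeff-∂ i q) ⟨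
    coeff i (∂ p) ℚ.+ coeff i (∂ q)                            ≡⟨ coeff-+ i (∂ p) (∂ q) ⟨
    coeff i (∂ p +P ∂ q)                                       ∎
    where
    open ≡.≡-Reasoning
    n = ℕ→ℚ (suc i)

∂-· : ∀ c p → ∂ (c ·P p) ≋ c ·P ∂ p
∂-· c p = mk≋ coeffs
  where
  coeffs : ∀ i → coeff i (∂ (c ·P p)) ≡ coeff i (c ·P ∂ p)
  coeffs i = begin
    coeff i (∂ (c ·P p))                       ≡⟨ coeff-∂ i (c ·P p) ⟩
    n ℚ.* coeff (suc i) (c ·P p)               ≡⟨ cong (n ℚ.*_) (coeff-· (suc i) c p) ⟩
    n ℚ.* (c ℚ.* coeff (suc i) p)              ≡⟨ ℚP.*-assoc n c (coeff (suc i) p) ⟨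
    (n ℚ.* c) ℚ.* coeff (suc i) p              ≡⟨ cong (ℚ._* coeff (suc i) p) (ℚP.*-comm n c) ⟩
    (c ℚ.* n) ℚ.* coeff (suc i) p              ≡⟨ ℚP.*-assoc c n (coeff (suc i) p) ⟩
    c ℚ.* (n ℚ.* coeff (suc i) p)              ≡⟨ cong (c ℚ.*_) (coeff-∂ i p) ⟨
    c ℚ.* coeff i (∂ p)                        ≡⟨ coeff-· i c (∂ p) ⟨
    coeff i (c ·P ∂ p)                         ∎
    where
    open ≡.≡-Reasoning
    n = ℕ→ℚ (suc i)

∂-const : ∀ c → ∂ (constP c) ≋ []
∂-const c = [0]≋[]

∂-z : ∂ zP ≋ 1P
∂-z = ∷-cong (ℚP.+-identityʳ 1ℚ) [0]≋[]

∂-constP-* : ∀ c p → ∂ (constP c *P p) ≋ constP c *P ∂ p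
∂-constP-* c p = ≋-trans (∂-cong (constP-*P c p)) (≋-trans (∂-· c p) (≋-sym (constP-*P c (∂ p))))

shift≋z* : ∀ p → shift p ≋ zP *P p
shift≋z* p = ≋-sym (begin
  0ℚ ·P p +P shift (1ℚ ·P p +P shift [])   ≈⟨ +P-cong (·P-zero p) (shift-cong (+P-cong (·P-identity p) [0]≋[])) ⟩
  shift (p +P [])                          ≈⟨ shift-cong (+P-identityʳ p) ⟩
  shift p                                  ∎)
  where open ≋-Reasoning

∷≋constP+z* : ∀ a p → (a ∷ p) ≋ constP a +P zP *P p
∷≋constP+z* a p = ≋-trans (∷-cong (sym (ℚP.+-identityʳ a)) ≋-refl) (+P-cong (≋-refl {constP a}) (shift≋z* p))

∂-* : ∀ p q → ∂ (p *P q) ≋ ∂ p *P q +P p *P ∂ q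
∂-* []      q = ≋-refl
∂-* (a ∷ p) q = begin
  ∂ (a ·P q +P shift (p *P q))
    ≈⟨ ∂-+ (a ·P q) (shift (p *P q)) ⟩
  ∂ (a ·P q) +P (p *P q +P shift (∂ (p *P q)))
    ≈⟨ +P-cong (≋-trans (∂-· a q) (≋-sym (constP-*P a (∂ q))))
               (+P-cong (≋-refl {p *P q}) (≋-trans (shift≋z* _) (*P-congʳ zP (∂-* p q)))) ⟩
  A *P ∂ q +P (p *P q +P zP *P (∂ p *P q +P p *P ∂ q))
    ≈⟨ PolySolver.solve 6 (λ A Z p q p′ q′ → (A ⊗ q′ ⊕ (p ⊗ q ⊕ Z ⊗ (p′ ⊗ q ⊕ p ⊗ q′)))
                                           ⊜ ((p ⊕ Z ⊗ p′) ⊗ q ⊕ (A ⊕ Z ⊗ p) ⊗ q′))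
         ≋-refl A zP p q (∂ p) (∂ q) ⟩
  (p +P zP *P ∂ p) *P q +P (A +P zP *P p) *P ∂ q
    ≈⟨ +P-cong (*P-congˡ q (+P-cong (≋-refl {p}) (≋-sym (shift≋z* (∂ p))))) (*P-congˡ (∂ q) (≋-sym (∷≋constP+z* a p))) ⟩
  (p +P shift (∂ p)) *P q +P (a ∷ p) *P ∂ q
    ∎
  where
  open ≋-Reasoning
  A = constP a

∂-^ : ∀ p n → ∂ (p ^P suc n) ≋ ℕ→P (suc n) *P (p ^P n *P ∂ p)
∂-^ p zero = begin
  ∂ (p *P 1P)              ≈⟨ ∂-cong (*P-identityʳ p) ⟩
  ∂ p                      ≈⟨ *P-identityˡ (∂ p) ⟨
  1P *P ∂ p                ≈⟨ *P-identityˡ (1P *P ∂ p) ⟨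
  1P *P (1P *P ∂ p)        ∎
  where open ≋-Reasoning
∂-^ p (suc n) = begin
  ∂ (p *P p ^P suc n)
    ≈⟨ ∂-* p (p ^P suc n) ⟩
  ∂ p *P p ^P suc n +P p *P ∂ (p ^P suc n)
    ≈⟨ +P-cong (≋-refl {∂ p *P p ^P suc n}) (*P-congʳ p (∂-^ p n)) ⟩
  ∂ p *P (p *P p ^P n) +P p *P (ℕ→P (suc n) *P (p ^P n *P ∂ p))
    ≈⟨ PolySolver.solve 4 (λ p′ p pⁿ m → (p′ ⊗ (p ⊗ pⁿ) ⊕ p ⊗ (m ⊗ (pⁿ ⊗ p′)))
                                       ⊜ ((Κ 1P ⊕ m) ⊗ ((p ⊗ pⁿ) ⊗ p′)))
         ≋-refl (∂ p) p (p ^P n) (ℕ→P (suc n)) ⟩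
  (1P +P ℕ→P (suc n)) *P (p ^P suc n *P ∂ p)
    ≈⟨ *P-congˡ _ (≋-sym (ℕ→P-suc (suc n))) ⟩
  ℕ→P (suc (suc n)) *P (p ^P suc n *P ∂ p)
    ∎
  where
  open ≋-Reasoning

≋-from-∂ : ∀ {p q} w → ∂ p ≋ ∂ q → eval p w ≡ eval q w → p ≋ q
≋-from-∂ {p} {q} w ∂p≋∂q evp≡evq = mk≋ λ { zero → constant-terms ; (suc i) → higher-terms i }
  where
  tail : Poly → Poly
  tail []      = []
  tail (a ∷ p) = p

  coeff-tail : ∀ i p → coeff i (tail p) ≡ coeff (suc i) p
  coeff-tail i []      = refl
  coeff-tail i (a ∷ p) = refl

  eval-tail : ∀ p → eval p w ≡ coeff 0 p ℚ.+ w ℚ.* eval (tail p) w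
  eval-tail []      = sym (trans (cong (0ℚ ℚ.+_) (ℚP.*-zeroʳ w)) (ℚP.+-identityʳ 0ℚ))
  eval-tail (a ∷ p) = refl

  higher-terms : ∀ i → coeff (suc i) p ≡ coeff (suc i) q
  higher-terms i = *-cancelˡ-≢0 (ℕ→ℚ-suc≢0 i)
    (trans (sym (coeff-∂ i p)) (trans (coeff-≡ ∂p≋∂q i) (coeff-∂ i q)))

  tails : tail p ≋ tail q
  tails = mk≋ λ i → trans (coeff-tail i p) (trans (higher-terms i) (sym (coeff-tail i q)))

  constant-terms : coeff 0 p ≡ coeff 0 q
  constant-terms = +-cancelʳ (w ℚ.* eval (tail p) w) (coeff 0 p) (coeff 0 q) (begin
    coeff 0 p ℚ.+ w ℚ.* eval (tail p) w   ≡⟨ eval-tail p ⟨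
    eval p w                              ≡⟨ evp≡evq ⟩
    eval q w                              ≡⟨ eval-tail q ⟩
    coeff 0 q ℚ.+ w ℚ.* eval (tail q) w   ≡⟨ cong (λ t → coeff 0 q ℚ.+ w ℚ.* t) (eval-cong w tails) ⟨
    coeff 0 q ℚ.+ w ℚ.* eval (tail p) w   ∎)
    where open ≡.≡-Reasoning

open CauchyProperties Poly-commutativeSemiring using (conv; conv-cong; conv-shiftˡ; conv-shiftʳ; conv-weighted)

-- Opaque so that the rational arithmetic in 1/k! is never unfolded during conversion checking.
opaque
  invFact : ℕ → ℚ
  invFact zero    = 1ℚ
  invFact (suc k) = invFact k ℚ.* (ℚ.1/ ℕ→ℚ (suc k)) {{ℕ→ℚ-suc-nonZero k}}

  invFact-zero : invFact 0 ≡ 1ℚ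
  invFact-zero = refl

  invFact-suc : ∀ k → invFact (suc k) ℚ.* ℕ→ℚ (suc k) ≡ invFact k
  invFact-suc k = trans (ℚP.*-assoc (invFact k) _ (ℕ→ℚ (suc k)))
    (trans (cong (invFact k ℚ.*_) (ℚP.*-inverseˡ (ℕ→ℚ (suc k)) {{ℕ→ℚ-suc-nonZero k}})) (ℚP.*-identityʳ (invFact k)))

constP-* : ∀ a b → constP (a ℚ.* b) ≋ constP a *P constP b
constP-* a b = ≋-sym (constP-*P a (constP b))

∂-+constP : ∀ p c → ∂ (p +P constP c) ≋ ∂ p
∂-+constP p c = ≋-trans (∂-+ p (constP c)) (≋-trans (+P-cong (≋-refl {∂ p}) (∂-const c)) (+P-identityʳ (∂ p)))

abelPolynomial : ℕ → Poly → Poly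
abelPolynomial zero    x = 1P
abelPolynomial (suc j) x = x *P (x +P ℕ→P (suc j)) ^P j

abel : ℕ → Poly → Poly
abel k x = constP (invFact k) *P abelPolynomial k x

abelPolynomial-cong : ∀ {x y} k → x ≋ y → abelPolynomial k x ≋ abelPolynomial k y
abelPolynomial-cong zero    e = ≋-refl
abelPolynomial-cong (suc j) e = *P-cong e (^P-cong j (+P-cong e ≋-refl))

abel-cong : ∀ {x y} k → x ≋ y → abel k x ≋ abel k y
abel-cong k e = *P-congʳ (constP (invFact k)) (abelPolynomial-cong k e)

abel-zero : ∀ x → abel 0 x ≋ 1P
abel-zero x = ≋-trans (*P-congˡ 1P (≡⇒≋ (cong constP invFact-zero))) (*P-identityˡ 1P)

eval-abel-cong : ∀ {x y} k w → eval x w ≡ eval y w → eval (abel k x) w ≡ eval (abel k y) w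
eval-abel-cong {x} {y} k w e = begin
  eval (abel k x) w                                        ≡⟨ eval-* (constP (invFact k)) (abelPolynomial k x) w ⟩
  eval (constP (invFact k)) w ℚ.* eval (abelPolynomial k x) w  ≡⟨ cong (eval (constP (invFact k)) w ℚ.*_) (polynomial k) ⟩
  eval (constP (invFact k)) w ℚ.* eval (abelPolynomial k y) w  ≡⟨ eval-* (constP (invFact k)) (abelPolynomial k y) w ⟨
  eval (abel k y) w                                        ∎
  where
  open ≡.≡-Reasoning
  polynomial : ∀ k → eval (abelPolynomial k x) w ≡ eval (abelPolynomial k y) w
  polynomial zero    = refl
  polynomial (suc j) = begin
    eval (x *P (x +P ℕ→P (suc j)) ^P j) w                  ≡⟨ eval-* x _ w ⟩
    eval x w ℚ.* eval ((x +P ℕ→P (suc j)) ^P j) w          ≡⟨ cong₂ ℚ._*_ e (eval-^-cong j w shifted) ⟩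
    eval y w ℚ.* eval ((y +P ℕ→P (suc j)) ^P j) w          ≡⟨ eval-* y _ w ⟨
    eval (y *P (y +P ℕ→P (suc j)) ^P j) w                  ∎
    where
    shifted : eval (x +P ℕ→P (suc j)) w ≡ eval (y +P ℕ→P (suc j)) w
    shifted = trans (eval-+ x _ w) (trans (cong (ℚ._+ eval (ℕ→P (suc j)) w) e) (sym (eval-+ y _ w)))

∂-abelPolynomial : ∀ j x → ∂ (abelPolynomial (suc j) x) ≋ ℕ→P (suc j) *P (abelPolynomial j (x +P 1P) *P ∂ x)
∂-abelPolynomial zero x = begin
  ∂ (x *P 1P)              ≈⟨ ∂-cong (*P-identityʳ x) ⟩
  ∂ x                      ≈⟨ *P-identityˡ (∂ x) ⟨
  1P *P ∂ x                ≈⟨ *P-identityˡ (1P *P ∂ x) ⟨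
  1P *P (1P *P ∂ x)        ∎
  where open ≋-Reasoning
∂-abelPolynomial (suc i) x = begin
  ∂ (x *P X ^P suc i)
    ≈⟨ ∂-* x (X ^P suc i) ⟩
  ∂ x *P (X *P X ^P i) +P x *P ∂ (X ^P suc i)
    ≈⟨ +P-cong (*P-congʳ (∂ x) (*P-congˡ (X ^P i) X≋))
               (*P-congʳ x (≋-trans (∂-^ X i) (*P-congʳ n (*P-congʳ (X ^P i) (∂-+constP x _))))) ⟩
  ∂ x *P ((x +P (1P +P n)) *P X ^P i) +P x *P (n *P (X ^P i *P ∂ x))
    ≈⟨ PolySolver.solve 4 (λ x′ x n Xⁱ → (x′ ⊗ ((x ⊕ (Κ 1P ⊕ n)) ⊗ Xⁱ) ⊕ x ⊗ (n ⊗ (Xⁱ ⊗ x′)))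
                                      ⊜ ((Κ 1P ⊕ n) ⊗ (((x ⊕ Κ 1P) ⊗ Xⁱ) ⊗ x′)))
         ≋-refl (∂ x) x n (X ^P i) ⟩
  (1P +P n) *P (((x +P 1P) *P X ^P i) *P ∂ x)
    ≈⟨ *P-cong (≋-sym (ℕ→P-suc (suc i))) (*P-congˡ (∂ x) (*P-congʳ (x +P 1P) (^P-cong i (≋-sym Y≋X)))) ⟩
  ℕ→P (suc (suc i)) *P (((x +P 1P) *P Y ^P i) *P ∂ x)
    ∎
  where
  open ≋-Reasoning
  n = ℕ→P (suc i)
  X = x +P ℕ→P (suc (suc i))
  Y = (x +P 1P) +P n
  X≋ : X ≋ x +P (1P +P n)
  X≋ = +P-cong (≋-refl {x}) (ℕ→P-suc (suc i))
  Y≋X : Y ≋ X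
  Y≋X = ≋-trans (+P-assoc x 1P n) (≋-sym X≋)

∂-abel : ∀ j x → ∂ (abel (suc j) x) ≋ abel j (x +P 1P) *P ∂ x
∂-abel j x = begin
  ∂ (c *P abelPolynomial (suc j) x)                        ≈⟨ ∂-constP-* (invFact (suc j)) (abelPolynomial (suc j) x) ⟩
  c *P ∂ (abelPolynomial (suc j) x)                        ≈⟨ *P-congʳ c (∂-abelPolynomial j x) ⟩
  c *P (ℕ→P (suc j) *P (abelPolynomial j (x +P 1P) *P ∂ x)) ≈⟨ *P-assoc c (ℕ→P (suc j)) _ ⟨
  (c *P ℕ→P (suc j)) *P (abelPolynomial j (x +P 1P) *P ∂ x) ≈⟨ *P-congˡ _ c·n≋ ⟩
  constP (invFact j) *P (abelPolynomial j (x +P 1P) *P ∂ x) ≈⟨ *P-assoc (constP (invFact j)) (abelPolynomial j (x +P 1P)) (∂ x) ⟨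
  abel j (x +P 1P) *P ∂ x                                  ∎
  where
  open ≋-Reasoning
  c = constP (invFact (suc j))
  c·n≋ : c *P ℕ→P (suc j) ≋ constP (invFact j)
  c·n≋ = ≋-trans (≋-sym (constP-* (invFact (suc j)) (ℕ→ℚ (suc j)))) (≡⇒≋ (cong constP (invFact-suc j)))

∂-conv : ∀ f g m → ∂ (conv f g m) ≋ conv (λ k → ∂ (f k)) g m +P conv f (λ k → ∂ (g k)) m
∂-conv f g zero    = ∂-* (f 0) (g 0)
∂-conv f g (suc m) = begin
  ∂ (f 0 *P g (suc m) +P conv f′ g m)
    ≈⟨ ∂-+ (f 0 *P g (suc m)) (conv f′ g m) ⟩
  ∂ (f 0 *P g (suc m)) +P ∂ (conv f′ g m)
    ≈⟨ +P-cong (∂-* (f 0) (g (suc m))) (∂-conv f′ g m) ⟩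
  (∂ (f 0) *P g (suc m) +P f 0 *P ∂ (g (suc m))) +P (conv (λ k → ∂ (f′ k)) g m +P conv f′ (λ k → ∂ (g k)) m)
    ≈⟨ +P-interchange (∂ (f 0) *P g (suc m)) _ _ _ ⟩
  (∂ (f 0) *P g (suc m) +P conv (λ k → ∂ (f′ k)) g m) +P (f 0 *P ∂ (g (suc m)) +P conv f′ (λ k → ∂ (g k)) m)
    ∎
  where
  open ≋-Reasoning
  f′ = λ k → f (suc k)

eval-*-vanishing : ∀ p q w → eval p w ≡ 0ℚ → eval (p *P q) w ≡ 0ℚ
eval-*-vanishing p q w p≡0 = trans (eval-* p q w) (trans (cong (ℚ._* eval q w) p≡0) (ℚP.*-zeroˡ (eval q w)))

eval-conv-vanishing : ∀ f g m w → (∀ k → eval (f k) w ≡ 0ℚ) → eval (conv f g m) w ≡ 0ℚ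
eval-conv-vanishing f g zero    w f≡0 = eval-*-vanishing (f 0) (g 0) w (f≡0 0)
eval-conv-vanishing f g (suc m) w f≡0 = trans (eval-+ (f 0 *P g (suc m)) _ w)
  (trans (cong₂ ℚ._+_ (eval-*-vanishing (f 0) (g (suc m)) w (f≡0 0))
                      (eval-conv-vanishing (λ k → f (suc k)) g m w (λ k → f≡0 (suc k))))
         (ℚP.+-identityˡ 0ℚ))

infix 8 z+_ 2z+_

z+_ : ℕ → Poly
z+ c = zP +P ℕ→P c

2z+_ : ℕ → Poly
2z+ c = (zP +P zP) +P ℕ→P c

z+-suc : ∀ c → z+ c +P 1P ≋ z+ suc c
z+-suc c = ≋-trans (+P-assoc zP (ℕ→P c) 1P) (+P-cong (≋-refl {zP}) (≋-trans (+P-comm (ℕ→P c) 1P) (≋-sym (ℕ→P-suc c))))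

2z+-suc : ∀ c → 2z+ c +P 1P ≋ 2z+ suc c
2z+-suc c = ≋-trans (+P-assoc (zP +P zP) (ℕ→P c) 1P) (+P-cong (≋-refl {zP +P zP}) (≋-trans (+P-comm (ℕ→P c) 1P) (≋-sym (ℕ→P-suc c))))

ℕ→P-0+ : ∀ c → ℕ→P 0 +P ℕ→P c ≋ ℕ→P c
ℕ→P-0+ c = ∷-cong (ℚP.+-identityˡ (ℕ→ℚ c)) ≋-refl

z+0+ : ∀ c → z+ 0 +P ℕ→P c ≋ z+ c
z+0+ c = ≋-trans (+P-assoc zP (ℕ→P 0) (ℕ→P c)) (+P-cong (≋-refl {zP}) (ℕ→P-0+ c))

2z+0+ : ∀ c → 2z+ 0 +P ℕ→P c ≋ 2z+ c
2z+0+ c = ≋-trans (+P-assoc (zP +P zP) (ℕ→P 0) (ℕ→P c)) (+P-cong (≋-refl {zP +P zP}) (ℕ→P-0+ c))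

∂-z+ : ∀ c → ∂ (z+ c) ≋ 1P
∂-z+ c = ≋-trans (∂-+constP zP (ℕ→ℚ c)) ∂-z

∂-2z+ : ∀ c → ∂ (2z+ c) ≋ 1P +P 1P
∂-2z+ c = ≋-trans (∂-+constP (zP +P zP) (ℕ→ℚ c)) (≋-trans (∂-+ zP zP) (+P-cong ∂-z ∂-z))

∂-abel-z+ : ∀ k c → ∂ (abel (suc k) (z+ c)) ≋ abel k (z+ suc c)
∂-abel-z+ k c = ≋-trans (∂-abel k (z+ c)) (≋-trans (*P-cong (abel-cong k (z+-suc c)) (∂-z+ c)) (*P-identityʳ _))

eval-z+ : ∀ c w → eval (z+ c) w ≡ w ℚ.+ ℕ→ℚ c
eval-z+ c w = trans (eval-+ zP (ℕ→P c) w) (cong₂ ℚ._+_ (eval-z w) (eval-const (ℕ→ℚ c) w))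

eval-2z+ : ∀ c w → eval (2z+ c) w ≡ (w ℚ.+ w) ℚ.+ ℕ→ℚ c
eval-2z+ c w = trans (eval-+ (zP +P zP) (ℕ→P c) w)
  (cong₂ ℚ._+_ (trans (eval-+ zP zP w) (cong₂ ℚ._+_ (eval-z w) (eval-z w))) (eval-const (ℕ→ℚ c) w))

eval-abel-z+-root : ∀ k c → eval (abel (suc k) (z+ c)) (ℚ.- ℕ→ℚ c) ≡ 0ℚ
eval-abel-z+-root k c =
  trans (eval-* C (z+ c *P X) w)
        (trans (cong (eval C w ℚ.*_) (eval-*-vanishing (z+ c) X w root)) (ℚP.*-zeroʳ (eval C w)))
  where
  w = ℚ.- ℕ→ℚ c
  C = constP (invFact (suc k))
  X = (z+ c +P ℕ→P (suc k)) ^P k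
  root : eval (z+ c) w ≡ 0ℚ
  root = trans (eval-z+ c w) (ℚP.+-inverseˡ (ℕ→ℚ c))

abel-convolution : ∀ m c d → conv (λ k → abel k (z+ c)) (λ k → abel k (z+ d)) m ≋ abel m (2z+ (c ℕ.+ d))
abel-convolution zero c d =
  ≋-trans (*P-cong (abel-zero (z+ c)) (abel-zero (z+ d))) (≋-trans (*P-identityˡ 1P) (≋-sym (abel-zero (2z+ (c ℕ.+ d)))))
abel-convolution (suc m) c d = ≋-from-∂ (ℚ.- ℕ→ℚ c) derivatives values
  where
  f = λ k → abel k (z+ c)
  g = λ k → abel k (z+ d)
  h = abel m (2z+ suc (c ℕ.+ d))

  derivatives : ∂ (conv f g (suc m)) ≋ ∂ (abel (suc m) (2z+ (c ℕ.+ d)))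
  derivatives = begin
    ∂ (conv f g (suc m))
      ≈⟨ ∂-conv f g (suc m) ⟩
    conv (λ k → ∂ (f k)) g (suc m) +P conv f (λ k → ∂ (g k)) (suc m)
      ≈⟨ +P-cong (conv-shiftˡ (λ k → ∂ (f k)) g m (≋-trans (∂-cong (abel-zero (z+ c))) (∂-const 1ℚ)))
                 (conv-shiftʳ f (λ k → ∂ (g k)) m (≋-trans (∂-cong (abel-zero (z+ d))) (∂-const 1ℚ))) ⟩
    conv (λ k → ∂ (f (suc k))) g m +P conv f (λ k → ∂ (g (suc k))) m
      ≈⟨ +P-cong (conv-cong m (λ k _ → ∂-abel-z+ k c) (λ k _ → ≋-refl)) (conv-cong m (λ k _ → ≋-refl) (λ k _ → ∂-abel-z+ k d)) ⟩
    conv (λ k → abel k (z+ suc c)) g m +P conv f (λ k → abel k (z+ suc d)) m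
      ≈⟨ +P-cong (abel-convolution m (suc c) d)
                 (≋-trans (abel-convolution m c (suc d)) (abel-cong m (≡⇒≋ (cong 2z+_ (ℕP.+-suc c d))))) ⟩
    h +P h
      ≈⟨ PolySolver.solve 1 (λ h → (h ⊕ h) ⊜ (h ⊗ (Κ 1P ⊕ Κ 1P))) ≋-refl h ⟩
    h *P (1P +P 1P)
      ≈⟨ *P-cong (abel-cong m (2z+-suc (c ℕ.+ d))) (∂-2z+ (c ℕ.+ d)) ⟨
    abel m (2z+ (c ℕ.+ d) +P 1P) *P ∂ (2z+ (c ℕ.+ d))
      ≈⟨ ∂-abel m (2z+ (c ℕ.+ d)) ⟨
    ∂ (abel (suc m) (2z+ (c ℕ.+ d)))
      ∎
    where open ≋-Reasoning

  w = ℚ.- ℕ→ℚ c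

  same-argument : eval (z+ d) w ≡ eval (2z+ (c ℕ.+ d)) w
  same-argument = begin
    eval (z+ d) w                              ≡⟨ eval-z+ d w ⟩
    w ℚ.+ ℕ→ℚ d                                ≡⟨ rearrange (ℕ→ℚ c) (ℕ→ℚ d) ⟩
    (w ℚ.+ w) ℚ.+ (ℕ→ℚ c ℚ.+ ℕ→ℚ d)            ≡⟨ cong ((w ℚ.+ w) ℚ.+_) (ℕ→ℚ-+ c d) ⟨
    (w ℚ.+ w) ℚ.+ ℕ→ℚ (c ℕ.+ d)                ≡⟨ eval-2z+ (c ℕ.+ d) w ⟨
    eval (2z+ (c ℕ.+ d)) w                     ∎
    where
    open ≡.≡-Reasoning
    open +-*-Solver
    rearrange : ∀ x y → (ℚ.- x) ℚ.+ y ≡ ((ℚ.- x) ℚ.+ (ℚ.- x)) ℚ.+ (x ℚ.+ y)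
    rearrange = solve 2 (λ x y → (:- x) :+ y := ((:- x) :+ (:- x)) :+ (x :+ y)) refl

  values : eval (conv f g (suc m)) w ≡ eval (abel (suc m) (2z+ (c ℕ.+ d))) w
  values = begin
    eval (f 0 *P g (suc m) +P conv (λ k → f (suc k)) g m) w
      ≡⟨ eval-+ (f 0 *P g (suc m)) _ w ⟩
    eval (f 0 *P g (suc m)) w ℚ.+ eval (conv (λ k → f (suc k)) g m) w
      ≡⟨ cong₂ ℚ._+_ (eval-cong w (≋-trans (*P-congˡ (g (suc m)) (abel-zero (z+ c))) (*P-identityˡ (g (suc m)))))
                     (eval-conv-vanishing (λ k → f (suc k)) g m w (λ k → eval-abel-z+-root k c)) ⟩
    eval (g (suc m)) w ℚ.+ 0ℚ
      ≡⟨ ℚP.+-identityʳ _ ⟩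
    eval (g (suc m)) w
      ≡⟨ eval-abel-cong {z+ d} {2z+ (c ℕ.+ d)} (suc m) w same-argument ⟩
    eval (abel (suc m) (2z+ (c ℕ.+ d))) w
      ∎
    where open ≡.≡-Reasoning

-- Fractions with cancellable denominators

Cancellable : Poly → Set
Cancellable p = ∀ x y → x *P p ≋ y *P p → x ≋ y

Cancellable-resp : ∀ {p q} → p ≋ q → Cancellable p → Cancellable q
Cancellable-resp p≋q cancel x y e = cancel x y (≋-trans (*P-congʳ x p≋q) (≋-trans e (*P-congʳ y (≋-sym p≋q))))

Cancellable-* : ∀ {p q} → Cancellable p → Cancellable q → Cancellable (p *P q)
Cancellable-* {p} {q} cancel-p cancel-q x y e =
  cancel-p x y (cancel-q (x *P p) (y *P p) (≋-trans (*P-assoc x p q) (≋-trans e (≋-sym (*P-assoc y p q)))))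

Cancellable-^ : ∀ {p} n → Cancellable p → Cancellable (p ^P n)
Cancellable-^ zero    cancel = λ x y e → ≋-trans (≋-sym (*P-identityʳ x)) (≋-trans e (*P-identityʳ y))
Cancellable-^ (suc n) cancel = Cancellable-* cancel (Cancellable-^ n cancel)

Cancellable-constP : ∀ {c} → c ≢ 0ℚ → Cancellable (constP c)
Cancellable-constP {c} c≢0 x y e = mk≋ λ i → *-cancelʳ-≢0 c≢0 (begin
  coeff i x ℚ.* c      ≡⟨ ℚP.*-comm (coeff i x) c ⟩
  c ℚ.* coeff i x      ≡⟨ coeff-· i c x ⟨
  coeff i (c ·P x)     ≡⟨ coeff-≡ (≋-trans (≋-sym (scale x)) (≋-trans e (scale y))) i ⟩
  coeff i (c ·P y)     ≡⟨ coeff-· i c y ⟩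
  c ℚ.* coeff i y      ≡⟨ ℚP.*-comm c (coeff i y) ⟩
  coeff i y ℚ.* c      ∎)
  where
  open ≡.≡-Reasoning
  scale : ∀ p → p *P constP c ≋ c ·P p
  scale p = ≋-trans (*P-comm p (constP c)) (constP-*P c p)

Cancellable-1 : Cancellable 1P
Cancellable-1 = Cancellable-constP (λ ())

-- Compare coefficients from the bottom up, cancelling a ≠ 0.
Cancellable-linear : ∀ {a b} → a ≢ 0ℚ → Cancellable (a ∷ b ∷ [])
Cancellable-linear {a} {b} a≢0 x y e = mk≋ coeffs
  where
  expand : ∀ u → u *P (a ∷ b ∷ []) ≋ a ·P u +P shift (b ·P u)
  expand u = ≋-trans (*P-∷ u a (b ∷ [])) (+P-cong (≋-refl {a ·P u}) (shift-cong (≋-trans (*P-∷ u b [])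
               (≋-trans (+P-cong (≋-refl {b ·P u}) (≋-trans (shift-cong (*P-zeroʳ u)) [0]≋[])) (+P-identityʳ (b ·P u))))))
  e′ : a ·P x +P shift (b ·P x) ≋ a ·P y +P shift (b ·P y)
  e′ = ≋-trans (≋-sym (expand x)) (≋-trans e (expand y))
  coeff-expand : ∀ i u → coeff (suc i) (a ·P u +P shift (b ·P u)) ≡ a ℚ.* coeff (suc i) u ℚ.+ b ℚ.* coeff i u
  coeff-expand i u = trans (coeff-+ (suc i) (a ·P u) (shift (b ·P u))) (cong₂ ℚ._+_ (coeff-· (suc i) a u) (coeff-· i b u))
  coeff-expand₀ : ∀ u → coeff 0 (a ·P u +P shift (b ·P u)) ≡ a ℚ.* coeff 0 u ℚ.+ 0ℚ
  coeff-expand₀ u = trans (coeff-+ 0 (a ·P u) (shift (b ·P u))) (cong (ℚ._+ 0ℚ) (coeff-· 0 a u))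
  coeffs : ∀ i → coeff i x ≡ coeff i y
  coeffs zero    = *-cancelˡ-≢0 a≢0 (+-cancelʳ 0ℚ _ _ (trans (sym (coeff-expand₀ x)) (trans (coeff-≡ e′ 0) (coeff-expand₀ y))))
  coeffs (suc i) = *-cancelˡ-≢0 a≢0 (+-cancelʳ (b ℚ.* coeff i x) _ _
    (trans (sym (coeff-expand i x)) (trans (coeff-≡ e′ (suc i))
      (trans (coeff-expand i y) (cong (λ t → a ℚ.* coeff (suc i) y ℚ.+ b ℚ.* t) (sym (coeffs i)))))))

infix 4 _≃_
_≃_ : RatFun → RatFun → Set
x ≃ y = num x *P den y ≋ num y *P den x

≃⇒≈R : ∀ {x y} → x ≃ y → x ≈R y
≃⇒≈R {a ⁄ b} {c ⁄ d} e = ≋[]⇒IsZeroP (mk≋ λ i → begin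
  coeff i (a *P d -P c *P b)                                ≡⟨ coeff-+ i (a *P d) (negP (c *P b)) ⟩
  coeff i (a *P d) ℚ.+ coeff i (negP (c *P b))              ≡⟨ cong₂ ℚ._+_ (coeff-≡ e i) (coeff-· i (ℚ.- 1ℚ) (c *P b)) ⟩
  coeff i (c *P b) ℚ.+ (ℚ.- 1ℚ) ℚ.* coeff i (c *P b)        ≡⟨ cancel (coeff i (c *P b)) ⟩
  0ℚ                                                        ∎)
  where
  open ≡.≡-Reasoning
  open +-*-Solver
  cancel : ∀ x → x ℚ.+ (ℚ.- 1ℚ) ℚ.* x ≡ 0ℚ
  cancel = solve 1 (λ x → x :+ (:- con 1ℚ) :* x := con 0ℚ) refl
  ≋[]⇒IsZeroP : ∀ {p} → p ≋ [] → IsZeroP p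
  ≋[]⇒IsZeroP {[]}    e = []
  ≋[]⇒IsZeroP {q ∷ p} e = coeff-≡ e 0 ∷ ≋[]⇒IsZeroP (mk≋ λ i → coeff-≡ e (suc i))

≃-trans : ∀ {x y z} → Cancellable (den y) → x ≃ y → y ≃ z → x ≃ z
≃-trans {a ⁄ b} {c ⁄ d} {e ⁄ f} cancel-d x≃y y≃z = cancel-d (a *P f) (e *P b) (begin
  (a *P f) *P d   ≈⟨ PolySolver.solve 3 (λ a f d → ((a ⊗ f) ⊗ d) ⊜ ((a ⊗ d) ⊗ f)) ≋-refl a f d ⟩
  (a *P d) *P f   ≈⟨ *P-congˡ f x≃y ⟩
  (c *P b) *P f   ≈⟨ PolySolver.solve 3 (λ c b f → ((c ⊗ b) ⊗ f) ⊜ ((c ⊗ f) ⊗ b)) ≋-refl c b f ⟩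
  (c *P f) *P b   ≈⟨ *P-congˡ b y≃z ⟩
  (e *P d) *P b   ≈⟨ PolySolver.solve 3 (λ e d b → ((e ⊗ d) ⊗ b) ⊜ ((e ⊗ b) ⊗ d)) ≋-refl e d b ⟩
  (e *P b) *P d   ∎)
  where open ≋-Reasoning

-- Cross-multiplication is transitive only through cancellable denominators.
record Frac : Set where
  constructor frac
  field
    ratFun      : RatFun
    cancellable : Cancellable (den ratFun)
open Frac

infix 4 _≈F_
record _≈F_ (x y : Frac) : Set where
  constructor mk≈F
  field cross : ratFun x ≃ ratFun y
open _≈F_

infixl 6 _+F_
infixl 7 _*F_

_+F_ : Frac → Frac → Frac
x +F y = frac (ratFun x +R ratFun y) (Cancellable-* (cancellable x) (cancellable y))

_*F_ : Frac → Frac → Frac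
x *F y = frac (ratFun x *R ratFun y) (Cancellable-* (cancellable x) (cancellable y))

0F 1F : Frac
0F = frac 0R Cancellable-1
1F = frac 1R Cancellable-1

polyF : Poly → Frac
polyF p = frac (polyR p) Cancellable-1

≈F-isEquivalence : IsEquivalence _≈F_
≈F-isEquivalence = record
  { refl  = mk≈F ≋-refl
  ; sym   = λ x≈y → mk≈F (≋-sym (cross x≈y))
  ; trans = λ {x} {y} {z} x≈y y≈z → mk≈F (≃-trans {ratFun x} {ratFun y} {ratFun z} (cancellable y) (cross x≈y) (cross y≈z))
  }

private
  open PolySolver using (Expr)

  infixl 6 _+ₑ_
  infixl 7 _*ₑ_
  infix 4 _≃ₑ_

  _+ₑ_ _*ₑ_ : ∀ {n} → Expr Poly n × Expr Poly n → Expr Poly n × Expr Poly n → Expr Poly n × Expr Poly n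
  (a , b) +ₑ (c , d) = (a ⊗ d ⊕ c ⊗ b , b ⊗ d)
  (a , b) *ₑ (c , d) = (a ⊗ c , b ⊗ d)

  _≃ₑ_ : ∀ {n} → Expr Poly n × Expr Poly n → Expr Poly n × Expr Poly n → Expr Poly n × Expr Poly n
  (a , b) ≃ₑ (c , d) = a ⊗ d ⊜ c ⊗ b

+F-cong : ∀ {x x′ y y′} → x ≈F x′ → y ≈F y′ → x +F y ≈F x′ +F y′
+F-cong {frac (a ⁄ b) _} {frac (a′ ⁄ b′) _} {frac (c ⁄ d) _} {frac (c′ ⁄ d′) _} (mk≈F x≈x′) (mk≈F y≈y′) = mk≈F (begin
  (a *P d +P c *P b) *P (b′ *P d′)
    ≈⟨ PolySolver.solve 6 (λ a b c d b′ d′ → ((a ⊗ d ⊕ c ⊗ b) ⊗ (b′ ⊗ d′)) ⊜ ((a ⊗ b′) ⊗ (d ⊗ d′) ⊕ (c ⊗ d′) ⊗ (b ⊗ b′)))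
         ≋-refl a b c d b′ d′ ⟩
  (a *P b′) *P (d *P d′) +P (c *P d′) *P (b *P b′)
    ≈⟨ +P-cong (*P-congˡ (d *P d′) x≈x′) (*P-congˡ (b *P b′) y≈y′) ⟩
  (a′ *P b) *P (d *P d′) +P (c′ *P d) *P (b *P b′)
    ≈⟨ PolySolver.solve 6 (λ a′ b c′ d b′ d′ → ((a′ ⊗ b) ⊗ (d ⊗ d′) ⊕ (c′ ⊗ d) ⊗ (b ⊗ b′)) ⊜ ((a′ ⊗ d′ ⊕ c′ ⊗ b′) ⊗ (b ⊗ d)))
         ≋-refl a′ b c′ d b′ d′ ⟩
  (a′ *P d′ +P c′ *P b′) *P (b *P d)
    ∎)
  where open ≋-Reasoning

*F-cong : ∀ {x x′ y y′} → x ≈F x′ → y ≈F y′ → x *F y ≈F x′ *F y′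
*F-cong {frac (a ⁄ b) _} {frac (a′ ⁄ b′) _} {frac (c ⁄ d) _} {frac (c′ ⁄ d′) _} (mk≈F x≈x′) (mk≈F y≈y′) = mk≈F (begin
  (a *P c) *P (b′ *P d′)   ≈⟨ PolySolver.solve 4 (λ a c b′ d′ → ((a ⊗ c) ⊗ (b′ ⊗ d′)) ⊜ ((a ⊗ b′) ⊗ (c ⊗ d′))) ≋-refl a c b′ d′ ⟩
  (a *P b′) *P (c *P d′)   ≈⟨ *P-cong x≈x′ y≈y′ ⟩
  (a′ *P b) *P (c′ *P d)   ≈⟨ PolySolver.solve 4 (λ a′ b c′ d → ((a′ ⊗ b) ⊗ (c′ ⊗ d)) ⊜ ((a′ ⊗ c′) ⊗ (b ⊗ d))) ≋-refl a′ b c′ d ⟩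
  (a′ *P c′) *P (b *P d)   ∎)
  where open ≋-Reasoning

+F-assoc : ∀ x y s → (x +F y) +F s ≈F x +F (y +F s)
+F-assoc (frac (a ⁄ b) _) (frac (c ⁄ d) _) (frac (e ⁄ f) _) =
  mk≈F (PolySolver.solve 6 (λ a b c d e f → (a , b) +ₑ (c , d) +ₑ (e , f) ≃ₑ (a , b) +ₑ ((c , d) +ₑ (e , f))) ≋-refl a b c d e f)

+F-comm : ∀ x y → x +F y ≈F y +F x
+F-comm (frac (a ⁄ b) _) (frac (c ⁄ d) _) =
  mk≈F (PolySolver.solve 4 (λ a b c d → (a , b) +ₑ (c , d) ≃ₑ (c , d) +ₑ (a , b)) ≋-refl a b c d)

+F-identityˡ : ∀ x → 0F +F x ≈F x
+F-identityˡ (frac (a ⁄ b) _) = mk≈F (*P-assoc a 1P b)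

*F-assoc : ∀ x y s → (x *F y) *F s ≈F x *F (y *F s)
*F-assoc (frac (a ⁄ b) _) (frac (c ⁄ d) _) (frac (e ⁄ f) _) =
  mk≈F (PolySolver.solve 6 (λ a b c d e f → (a , b) *ₑ (c , d) *ₑ (e , f) ≃ₑ (a , b) *ₑ ((c , d) *ₑ (e , f))) ≋-refl a b c d e f)

*F-comm : ∀ x y → x *F y ≈F y *F x
*F-comm (frac (a ⁄ b) _) (frac (c ⁄ d) _) =
  mk≈F (PolySolver.solve 4 (λ a b c d → (a , b) *ₑ (c , d) ≃ₑ (c , d) *ₑ (a , b)) ≋-refl a b c d)

*F-identityˡ : ∀ x → 1F *F x ≈F x
*F-identityˡ (frac (a ⁄ b) _) =
  mk≈F (PolySolver.solve 2 (λ a b → (Κ 1P , Κ 1P) *ₑ (a , b) ≃ₑ (a , b)) ≋-refl a b)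

*F-distribʳ : ∀ x y s → (y +F s) *F x ≈F y *F x +F s *F x
*F-distribʳ (frac (a ⁄ b) _) (frac (c ⁄ d) _) (frac (e ⁄ f) _) =
  mk≈F (PolySolver.solve 6 (λ a b c d e f → ((c , d) +ₑ (e , f)) *ₑ (a , b) ≃ₑ (c , d) *ₑ (a , b) +ₑ (e , f) *ₑ (a , b))
    ≋-refl a b c d e f)

Frac-isCommutativeSemiring : IsCommutativeSemiring _≈F_ _+F_ _*F_ 0F 1F
Frac-isCommutativeSemiring = IsCommutativeSemiringˡ.isCommutativeSemiring record
  { +-isCommutativeMonoid = IsCommutativeMonoidˡ.isCommutativeMonoid record
    { isSemigroup = record
      { isMagma = record { isEquivalence = ≈F-isEquivalence ; ∙-cong = +F-cong }
      ; assoc = +F-assoc }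
    ; identityˡ = +F-identityˡ
    ; comm = +F-comm }
  ; *-isCommutativeMonoid = IsCommutativeMonoidˡ.isCommutativeMonoid record
    { isSemigroup = record
      { isMagma = record { isEquivalence = ≈F-isEquivalence ; ∙-cong = *F-cong }
      ; assoc = *F-assoc }
    ; identityˡ = *F-identityˡ
    ; comm = *F-comm }
  ; distribʳ = *F-distribʳ
  ; zeroˡ = λ x → mk≈F ≋-refl
  }

Frac-commutativeSemiring : CommutativeSemiring _ _
Frac-commutativeSemiring = record { isCommutativeSemiring = Frac-isCommutativeSemiring }

polyF-cong : ∀ {p q} → p ≋ q → polyF p ≈F polyF q
polyF-cong p≋q = mk≈F (*P-congˡ 1P p≋q)

polyF-+ : ∀ p q → polyF (p +P q) ≈F polyF p +F polyF q
polyF-+ p q = mk≈F (PolySolver.solve 2 (λ p q → (p ⊕ q , Κ 1P) ≃ₑ (p , Κ 1P) +ₑ (q , Κ 1P)) ≋-refl p q)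

polyF-* : ∀ p q → polyF (p *P q) ≈F polyF p *F polyF q
polyF-* p q = mk≈F (PolySolver.solve 2 (λ p q → (p ⊗ q , Κ 1P) ≃ₑ (p , Κ 1P) *ₑ (q , Κ 1P)) ≋-refl p q)

numerator-^R : ∀ p n → num (polyR p ^R n) ≡ p ^P n
numerator-^R p zero    = refl
numerator-^R p (suc n) = cong (p *P_) (numerator-^R p n)

denominator-^R : ∀ p n → den (polyR p ^R n) ≋ 1P
denominator-^R p zero    = ≋-refl
denominator-^R p (suc n) = ≋-trans (*P-congʳ 1P (denominator-^R p n)) (*P-identityˡ 1P)

2·p≋p+p : ∀ p → ℕ→ℚ 2 ·P p ≋ p +P p
2·p≋p+p p = begin
  ℕ→ℚ 2 ·P p         ≈⟨ constP-*P (ℕ→ℚ 2) p ⟨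
  ℕ→P 2 *P p         ≈⟨ *P-congˡ p (ℕ→P-suc 1) ⟩
  (1P +P ℕ→P 1) *P p ≈⟨ PolySolver.solve 1 (λ p → ((Κ 1P ⊕ Κ 1P) ⊗ p) ⊜ (p ⊕ p)) ≋-refl p ⟩
  p +P p             ∎
  where open ≋-Reasoning

-- For h ≥ 2 both integer exponents of hookFactor h are natural numbers; for h = 1 the second one is -1.

numerator-hookFactor : ∀ j → num (hookFactor (suc (suc j))) ≋ (z+ suc (suc j)) ^P suc j
numerator-hookFactor j =
  ≋-trans (*P-congʳ (num (polyR (z+ suc (suc j)) ^R suc j)) (≋-trans (*P-identityˡ _) (denominator-^R _ j)))
          (≋-trans (*P-identityʳ _) (≡⇒≋ (numerator-^R (z+ suc (suc j)) (suc j))))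

denominator-hookFactor : ∀ j → den (hookFactor (suc (suc j))) ≋ ℕ→P (suc (suc j)) *P (2z+ suc j) ^P j
denominator-hookFactor j =
  ≋-trans (*P-congˡ _ (denominator-^R (z+ suc (suc j)) (suc j)))
          (≋-trans (*P-identityˡ _) (*P-congʳ (ℕ→P (suc (suc j)))
            (≋-trans (≡⇒≋ (numerator-^R _ j)) (^P-cong j (+P-cong (2·p≋p+p zP) (≋-refl {ℕ→P (suc j)}))))))

numerator-hookFactor-1 : num (hookFactor 1) ≋ 2z+ 0
numerator-hookFactor-1 = ≋-trans (*P-identityˡ _) (≋-trans (*P-identityˡ _) (≋-trans (*P-identityʳ _)
  (+P-cong (2·p≋p+p zP) (≋-refl {ℕ→P 0}))))

denominator-hookFactor-1 : den (hookFactor 1) ≋ 1P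
denominator-hookFactor-1 = ≋-trans (*P-identityˡ _) (≋-trans (*P-identityˡ _) (*P-identityˡ 1P))

Cancellable-2z+ : ∀ j → Cancellable (2z+ suc j)
Cancellable-2z+ j = Cancellable-resp (≋-sym linear) (Cancellable-linear (ℕ→ℚ-suc≢0 j))
  where
  linear : 2z+ suc j ≋ ℕ→ℚ (suc j) ∷ (1ℚ ℚ.+ 1ℚ) ∷ []
  linear = ∷-cong (ℚP.+-identityˡ (ℕ→ℚ (suc j))) ≋-refl

hookFactor-cancellable : ∀ m → Cancellable (den (hookFactor (suc m)))
hookFactor-cancellable zero    = Cancellable-resp (≋-sym denominator-hookFactor-1) Cancellable-1
hookFactor-cancellable (suc j) = Cancellable-resp (≋-sym (denominator-hookFactor j))
  (Cancellable-* (Cancellable-constP (ℕ→ℚ-suc≢0 (suc j))) (Cancellable-^ j (Cancellable-2z+ j)))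

hookProd-cancellable : ∀ t → Cancellable (den (hookProd t))
hookProd-cancellable empty      = Cancellable-1
hookProd-cancellable (node l r) =
  Cancellable-* (hookFactor-cancellable (size l ℕ.+ size r)) (Cancellable-* (hookProd-cancellable l) (hookProd-cancellable r))

hookFactorF : ℕ → Frac
hookFactorF m = frac (hookFactor (suc m)) (hookFactor-cancellable m)

hookF : BTree → Frac
hookF t = frac (hookProd t) (hookProd-cancellable t)

closedForm : ℕ → Poly
closedForm n = ℕ→P 2 ^P n *P abel n (z+ 0)

conv-closedForm : ∀ m → conv closedForm closedForm m ≋ ℕ→P 2 ^P m *P abel m (2z+ 0)
conv-closedForm m = ≋-trans (conv-weighted (ℕ→P 2 ^P_) (^P-+ (ℕ→P 2)) 0 f f m)
                            (*P-congʳ (ℕ→P 2 ^P m) (abel-convolution m 0 0))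
  where
  f = λ k → abel k (z+ 0)

2z+0≋ : 2z+ 0 ≋ ℕ→P 2 *P z+ 0
2z+0≋ = begin
  (zP +P zP) +P ℕ→P 0       ≈⟨ +P-cong (≋-refl {zP +P zP}) [0]≋[] ⟩
  (zP +P zP) +P []          ≈⟨ +P-identityʳ (zP +P zP) ⟩
  zP +P zP                  ≈⟨ 2·p≋p+p zP ⟨
  ℕ→ℚ 2 ·P zP               ≈⟨ constP-*P (ℕ→ℚ 2) zP ⟨
  ℕ→P 2 *P zP               ≈⟨ *P-congʳ (ℕ→P 2) (≋-trans (≋-sym (+P-identityʳ zP)) (+P-cong (≋-refl {zP}) (≋-sym [0]≋[]))) ⟩
  ℕ→P 2 *P z+ 0             ∎
  where open ≋-Reasoning

invFact-one : invFact 1 ≡ 1ℚ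
invFact-one = trans (sym (ℚP.*-identityʳ (invFact 1))) (trans (invFact-suc 0) invFact-zero)

invFact-constP : ∀ k → constP (invFact k) ≋ constP (invFact (suc k)) *P ℕ→P (suc k)
invFact-constP k = ≋-trans (≡⇒≋ (cong constP (sym (invFact-suc k)))) (constP-* (invFact (suc k)) (ℕ→ℚ (suc k)))

hookFactor-step : ∀ m → hookFactorF m *F polyF (ℕ→P 2 ^P m *P abel m (2z+ 0)) ≈F polyF (closedForm (suc m))
hookFactor-step zero = mk≈F (begin
  (num (hookFactor 1) *P (1P *P abel 0 (2z+ 0))) *P 1P
    ≈⟨ *P-congˡ 1P (*P-cong (≋-trans numerator-hookFactor-1 2z+0≋) (≋-trans (*P-identityˡ _) (abel-zero (2z+ 0)))) ⟩
  ((T *P Z) *P 1P) *P 1P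
    ≈⟨ PolySolver.solve 2 (λ T Z → (((T ⊗ Z) ⊗ Κ 1P) ⊗ Κ 1P) ⊜ ((T ⊗ Κ 1P) ⊗ (Κ 1P ⊗ (Z ⊗ Κ 1P))) ⊗ (Κ 1P ⊗ Κ 1P))
         ≋-refl T Z ⟩
  ((T *P 1P) *P (1P *P (Z *P 1P))) *P (1P *P 1P)
    ≈⟨ *P-cong (*P-congʳ (T *P 1P) (*P-congˡ (Z *P 1P) (≡⇒≋ (cong constP invFact-one))))
               (*P-congˡ 1P denominator-hookFactor-1) ⟨
  closedForm 1 *P (den (hookFactor 1) *P 1P)
    ∎)
  where
  open ≋-Reasoning
  T = ℕ→P 2
  Z = z+ 0
hookFactor-step (suc j) = mk≈F (begin
  (num (hookFactor h) *P (T′ *P abel (suc j) (2z+ 0))) *P 1P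
    ≈⟨ *P-congˡ 1P (*P-cong (numerator-hookFactor j)
         (*P-congʳ T′ (*P-cong (invFact-constP (suc j)) (*P-cong 2z+0≋ (^P-cong j (2z+0+ (suc j))))))) ⟩
  (U *P (T′ *P ((c *P H) *P ((T *P Z) *P Rʲ)))) *P 1P
    ≈⟨ PolySolver.solve 7 (λ U T T′ c H Z Rʲ → ((U ⊗ (T′ ⊗ ((c ⊗ H) ⊗ ((T ⊗ Z) ⊗ Rʲ)))) ⊗ Κ 1P)
                                            ⊜ (((T ⊗ T′) ⊗ (c ⊗ (Z ⊗ U))) ⊗ ((H ⊗ Rʲ) ⊗ Κ 1P)))
         ≋-refl U T T′ c H Z Rʲ ⟩
  ((T *P T′) *P (c *P (Z *P U))) *P ((H *P Rʲ) *P 1P)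
    ≈⟨ *P-cong (*P-congʳ (T *P T′) (*P-congʳ c (*P-congʳ Z (^P-cong (suc j) (z+0+ h)))))
               (*P-congˡ 1P (denominator-hookFactor j)) ⟨
  closedForm h *P (den (hookFactor h) *P 1P)
    ∎)
  where
  open ≋-Reasoning
  h = suc (suc j)
  T = ℕ→P 2
  T′ = T ^P suc j
  c = constP (invFact h)
  H = ℕ→P h
  Z = z+ 0
  U = (z+ h) ^P suc j
  Rʲ = (2z+ suc j) ^P j

ℕ→P-^ : ∀ a n → ℕ→P a ^P n ≋ ℕ→P (a ^ n)
ℕ→P-^ a zero    = ≋-refl
ℕ→P-^ a (suc n) = ≋-trans (*P-congʳ (ℕ→P a) (ℕ→P-^ a n))
  (≋-trans (≋-sym (constP-* (ℕ→ℚ a) (ℕ→ℚ (a ^ n)))) (≡⇒≋ (cong constP (sym (ℕ→ℚ-* a (a ^ n))))))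

invFact-! : ∀ k → invFact k ℚ.* ℕ→ℚ (k !) ≡ 1ℚ
invFact-! zero    = trans (cong (ℚ._* 1ℚ) invFact-zero) (ℚP.*-identityˡ 1ℚ)
invFact-! (suc k) = begin
  invFact (suc k) ℚ.* ℕ→ℚ (suc k ℕ.* k !)                    ≡⟨ cong (invFact (suc k) ℚ.*_) (ℕ→ℚ-* (suc k) (k !)) ⟩
  invFact (suc k) ℚ.* (ℕ→ℚ (suc k) ℚ.* ℕ→ℚ (k !))            ≡⟨ ℚP.*-assoc (invFact (suc k)) (ℕ→ℚ (suc k)) (ℕ→ℚ (k !)) ⟨
  (invFact (suc k) ℚ.* ℕ→ℚ (suc k)) ℚ.* ℕ→ℚ (k !)            ≡⟨ cong (ℚ._* ℕ→ℚ (k !)) (invFact-suc k) ⟩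
  invFact k ℚ.* ℕ→ℚ (k !)                                   ≡⟨ invFact-! k ⟩
  1ℚ                                                        ∎
  where open ≡.≡-Reasoning

closedForm≃rhs : ∀ m → polyR (closedForm (suc m)) ≃ rhs (suc m)
closedForm≃rhs m = begin
  (T *P (c *P (z+ 0 *P (z+ 0 +P ℕ→P n) ^P m))) *P F
    ≈⟨ *P-congˡ F (*P-cong (ℕ→P-^ 2 n) (*P-congʳ c (*P-cong z+0≋z (^P-cong m (≋-trans (z+0+ n) (+P-comm zP (ℕ→P n))))))) ⟩
  (T′ *P (c *P (zP *P W))) *P F
    ≈⟨ PolySolver.solve 5 (λ T′ c z W F → ((T′ ⊗ (c ⊗ (z ⊗ W))) ⊗ F) ⊜ ((c ⊗ F) ⊗ (((T′ ⊗ z) ⊗ W) ⊗ Κ 1P))) ≋-refl T′ c zP W F ⟩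
  (c *P F) *P (((T′ *P zP) *P W) *P 1P)
    ≈⟨ *P-cong c·F≋1 (*P-congˡ 1P (*P-congˡ W (constP-*P (ℕ→ℚ (2 ^ n)) zP))) ⟩
  1P *P (((ℕ→ℚ (2 ^ n) ·P zP) *P W) *P 1P)
    ≈⟨ *P-identityˡ _ ⟩
  ((ℕ→ℚ (2 ^ n) ·P zP) *P W) *P 1P
    ∎
  where
  open ≋-Reasoning
  n = suc m
  T = ℕ→P 2 ^P n
  T′ = ℕ→P (2 ^ n)
  c = constP (invFact n)
  F = constP (ℕ→ℚ (n !))
  W = (ℕ→P n +P zP) ^P m
  z+0≋z : z+ 0 ≋ zP
  z+0≋z = ≋-trans (+P-cong (≋-refl {zP}) [0]≋[]) (+P-identityʳ zP)
  c·F≋1 : c *P F ≋ 1P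
  c·F≋1 = ≋-trans (≋-sym (constP-* (invFact n) (ℕ→ℚ (n !)))) (≡⇒≋ (cong constP (invFact-! n)))

-- Enumerating binary trees

record Enumerates (P : BTree → Set) (xs : List BTree) : Set where
  field
    sound    : All P xs
    complete : ∀ t → P t → t ∈ xs
    unique   : Unique xs
open Enumerates

HasSize : ℕ → BTree → Set
HasSize n t = size t ≡ n

Enumerates-resp : ∀ {P Q xs} → (∀ {t} → P t → Q t) → (∀ {t} → Q t → P t) → Enumerates P xs → Enumerates Q xs
Enumerates-resp P⇒Q Q⇒P e = record
  { sound    = All.map P⇒Q (sound e)
  ; complete = λ t q → complete e t (Q⇒P q)
  ; unique   = unique e
  }

enumerations-↭ : ∀ {P xs ys} → Enumerates P xs → Enumerates P ys → xs ↭ ys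
enumerations-↭ ex ey = ∼bag⇒↭ (unique∧set⇒bag (unique ex) (unique ey) (λ {t} → mk⇔
  (λ t∈xs → complete ey t (All.lookup (sound ex) t∈xs))
  (λ t∈ys → complete ex t (All.lookup (sound ey) t∈ys))))

Enumerates-++ : ∀ {P Q xs ys} → Enumerates P xs → Enumerates Q ys → (∀ {t} → P t → Q t → ⊥) →
                Enumerates (λ t → P t ⊎ Q t) (xs ++ ys)
Enumerates-++ {xs = xs} ex ey disjoint = record
  { sound    = All.++⁺ (All.map inj₁ (sound ex)) (All.map inj₂ (sound ey))
  ; complete = λ { t (inj₁ p) → Membership.∈-++⁺ˡ (complete ex t p)
                 ; t (inj₂ q) → Membership.∈-++⁺ʳ xs (complete ey t q) }
  ; unique   = Unique.++⁺ (unique ex) (unique ey)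
                 (λ (t∈xs , t∈ys) → disjoint (All.lookup (sound ex) t∈xs) (All.lookup (sound ey) t∈ys))
  }

data NodeOf (P Q : BTree → Set) : BTree → Set where
  nodeOf : ∀ {l r} → P l → Q r → NodeOf P Q (node l r)

pairs : List BTree → List BTree → List BTree
pairs = cartesianProductWith node

node-injective : ∀ {l l′ r r′ : BTree} → node l r ≡ node l′ r′ → l ≡ l′ × r ≡ r′
node-injective refl = refl , refl

Enumerates-pairs : ∀ {P Q xs ys} → Enumerates P xs → Enumerates Q ys → Enumerates (NodeOf P Q) (pairs xs ys)
Enumerates-pairs {xs = xs} {ys} ex ey = record
  { sound    = All.tabulate λ t∈ → sound-pair (Membership.∈-cartesianProductWith⁻ node xs ys t∈)
  ; complete = λ { .(node _ _) (nodeOf {l} {r} p q) →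
                   Membership.∈-cartesianProductWith⁺ node (complete ex l p) (complete ey r q) }
  ; unique   = Unique.cartesianProductWith⁺ node node-injective (unique ex) (unique ey)
  }
  where
  sound-pair : ∀ {t} → _ → NodeOf _ _ t
  sound-pair (l , r , l∈ , r∈ , refl) = nodeOf (All.lookup (sound ex) l∈) (All.lookup (sound ey) r∈)

data Split (o m : ℕ) : BTree → Set where
  split : ∀ {l r} → o ≤ size l → size l ℕ.+ size r ≡ o ℕ.+ m → Split o m (node l r)

Split-zero⁺ : ∀ {o t} → NodeOf (HasSize (o ℕ.+ 0)) (HasSize 0) t → Split o 0 t
Split-zero⁺ {o} (nodeOf {l} {r} l≡o r≡0) =
  split (subst (o ≤_) (sym l≡o) (ℕP.m≤m+n o 0)) (trans (cong₂ ℕ._+_ l≡o r≡0) (ℕP.+-identityʳ (o ℕ.+ 0)))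

Split-zero⁻ : ∀ {o t} → Split o 0 t → NodeOf (HasSize (o ℕ.+ 0)) (HasSize 0) t
Split-zero⁻ {o} (split {l} {r} o≤l l+r≡o) = nodeOf (trans l≡o (sym (ℕP.+-identityʳ o))) r≡0
  where
  l≤o : size l ≤ o
  l≤o = subst (size l ≤_) (trans l+r≡o (ℕP.+-identityʳ o)) (ℕP.m≤m+n (size l) (size r))
  l≡o : size l ≡ o
  l≡o = ℕP.≤-antisym l≤o o≤l
  r≡0 : size r ≡ 0
  r≡0 = ℕP.+-cancelˡ-≡ (size l) (size r) 0 (trans l+r≡o (trans (ℕP.+-identityʳ o) (trans (sym l≡o) (sym (ℕP.+-identityʳ (size l))))))

Split-suc⁺ : ∀ {o m t} → NodeOf (HasSize (o ℕ.+ 0)) (HasSize (suc m)) t ⊎ Split (suc o) m t → Split o (suc m) t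
Split-suc⁺ {o} {m} (inj₁ (nodeOf l≡o r≡m)) =
  split (subst (o ≤_) (sym l≡o) (ℕP.m≤m+n o 0)) (trans (cong₂ ℕ._+_ l≡o r≡m) (cong (ℕ._+ suc m) (ℕP.+-identityʳ o)))
Split-suc⁺ {o} {m} (inj₂ (split o<l l+r≡)) = split (ℕP.<⇒≤ o<l) (trans l+r≡ (sym (ℕP.+-suc o m)))

Split-suc⁻ : ∀ {o m t} → Split o (suc m) t → NodeOf (HasSize (o ℕ.+ 0)) (HasSize (suc m)) t ⊎ Split (suc o) m t
Split-suc⁻ {o} {m} (split {l} {r} o≤l l+r≡) with ℕP.m≤n⇒m<n∨m≡n o≤l
... | inj₁ o<l = inj₂ (split o<l (trans l+r≡ (ℕP.+-suc o m)))
... | inj₂ o≡l = inj₁ (nodeOf (trans (sym o≡l) (sym (ℕP.+-identityʳ o)))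
                              (ℕP.+-cancelˡ-≡ (size l) (size r) (suc m) (trans l+r≡ (cong (ℕ._+ suc m) o≡l))))

Split-suc-disjoint : ∀ {o m t} → NodeOf (HasSize (o ℕ.+ 0)) (HasSize (suc m)) t → Split (suc o) m t → ⊥
Split-suc-disjoint {o} (nodeOf l≡o _) (split o<l _) = ℕP.<-irrefl (sym (trans l≡o (ℕP.+-identityʳ o))) o<l

-- The offset o absorbs the shift of F in each unfolding of cauchy.
conv-enumerates : ∀ o m F G → (∀ k → k ≤ m → Enumerates (HasSize (o ℕ.+ k)) (F k)) →
                  (∀ k → k ≤ m → Enumerates (HasSize k) (G k)) → Enumerates (Split o m) (cauchy _++_ pairs F G m)
conv-enumerates o zero    F G hF hG =
  Enumerates-resp Split-zero⁺ Split-zero⁻ (Enumerates-pairs (hF 0 z≤n) (hG 0 z≤n))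
conv-enumerates o (suc m) F G hF hG = Enumerates-resp Split-suc⁺ Split-suc⁻
  (Enumerates-++ (Enumerates-pairs (hF 0 z≤n) (hG (suc m) ℕP.≤-refl))
                 (conv-enumerates (suc o) m (λ k → F (suc k)) G hF′ (λ k k≤m → hG k (ℕP.m≤n⇒m≤1+n k≤m)))
                 Split-suc-disjoint)
  where
  hF′ : ∀ k → k ≤ m → Enumerates (HasSize (suc o ℕ.+ k)) (F (suc k))
  hF′ k k≤m = subst (λ n → Enumerates (HasSize n) (F (suc k))) (ℕP.+-suc o k) (hF (suc k) (s≤s k≤m))

-- The first argument is fuel: trees f n enumerates the trees of size n whenever n ≤ f.
trees : ℕ → ℕ → List BTree
trees _       zero    = empty ∷ []
trees zero    (suc m) = []
trees (suc f) (suc m) = cauchy _++_ pairs (trees f) (trees f) m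

trees-enumerates : ∀ f n → n ≤ f → Enumerates (HasSize n) (trees f n)
trees-enumerates f       zero    _         = record
  { sound    = refl ∷ []
  ; complete = λ { empty _ → here refl ; (node l r) () }
  ; unique   = [] ∷ []
  }
trees-enumerates (suc f) (suc m) (s≤s m≤f) = Enumerates-resp Split⇒size size⇒Split
  (conv-enumerates 0 m (trees f) (trees f) IH IH)
  where
  IH : ∀ k → k ≤ m → Enumerates (HasSize k) (trees f k)
  IH k k≤m = trees-enumerates f k (ℕP.≤-trans k≤m m≤f)
  Split⇒size : ∀ {t} → Split 0 m t → size t ≡ suc m
  Split⇒size (split _ l+r≡m) = cong suc l+r≡m
  size⇒Split : ∀ {t} → size t ≡ suc m → Split 0 m t
  size⇒Split {node l r} size≡ = split z≤n (ℕP.suc-injective size≡)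

-- Hook sums

open CommutativeSemiring Frac-commutativeSemiring using (semiring) renaming
  (setoid to Frac-setoid; +-isCommutativeMonoid to +F-isCommutativeMonoid; +-identityʳ to +F-identityʳ; zeroʳ to *F-zeroʳ; *-congˡ to *F-congˡ; distribˡ to *F-distribˡ;
   refl to ≈F-refl; sym to ≈F-sym; trans to ≈F-trans; reflexive to ≈F-reflexive)
open SemiringSums semiring using (sum; sum-++; sum-cartesianProductWith)
open CauchyProperties Frac-commutativeSemiring using () renaming (conv to convF; conv-cong to convF-cong; conv-homomorphic to convF-homomorphic)
module ≈F-Reasoning = SetoidReasoning Frac-setoid

hookSum : List BTree → Frac
hookSum ts = sum (map hookF ts)

ratFun-hookSum : ∀ ts → ratFun (hookSum ts) ≡ sumR (map hookProd ts)
ratFun-hookSum []       = refl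
ratFun-hookSum (t ∷ ts) = cong (hookProd t +R_) (ratFun-hookSum ts)

childF : BTree → Frac
childF empty      = 1F
childF (node l r) = hookF l *F hookF r

hookF-node : ∀ {l r m} → size l ℕ.+ size r ≡ m → hookF (node l r) ≈F hookFactorF m *F childF (node l r)
hookF-node refl = ≈F-refl

hookSum-size : ∀ m ts → All (HasSize (suc m)) ts → hookSum ts ≈F hookFactorF m *F sum (map childF ts)
hookSum-size m []              []              = ≈F-sym (*F-zeroʳ (hookFactorF m))
hookSum-size m (node l r ∷ ts) (size≡ ∷ sizes) = begin
  hookF (node l r) +F hookSum ts
    ≈⟨ +F-cong (hookF-node {l} {r} (ℕP.suc-injective size≡)) (hookSum-size m ts sizes) ⟩
  hookFactorF m *F childF (node l r) +F hookFactorF m *F sum (map childF ts)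
    ≈⟨ *F-distribˡ (hookFactorF m) (childF (node l r)) (sum (map childF ts)) ⟨
  hookFactorF m *F (childF (node l r) +F sum (map childF ts))
    ∎
  where open ≈F-Reasoning

childSum-conv : ∀ F G m → sum (map childF (cauchy _++_ pairs F G m)) ≈F convF (λ k → hookSum (F k)) (λ k → hookSum (G k)) m
childSum-conv = convF-homomorphic _++_ pairs (λ ts → sum (map childF ts)) hookSum
  (λ xs ys → ≈F-trans (≈F-reflexive (cong sum (map-++ childF xs ys))) (sum-++ (map childF xs) (map childF ys)))
  (sum-cartesianProductWith node childF hookF hookF (λ l r → ≈F-refl))

hookSum-↭ : ∀ {xs ys} → xs ↭ ys → hookSum xs ≈F hookSum ys
hookSum-↭ xs↭ys = foldr-commMonoid Frac-setoid +F-isCommutativeMonoid (↭⇒↭ₛ′ ≈F-isEquivalence (Perm.map⁺ hookF xs↭ys))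

closedForm-zero : closedForm 0 ≋ 1P
closedForm-zero = ≋-trans (*P-identityˡ (abel 0 (z+ 0))) (abel-zero (z+ 0))

hookSum-trees : ∀ f n → n ≤ f → hookSum (trees f n) ≈F polyF (closedForm n)
hookSum-trees f zero _ = begin
  hookF empty +F 0F        ≈⟨ +F-identityʳ (hookF empty) ⟩
  polyF 1P                 ≈⟨ polyF-cong closedForm-zero ⟨
  polyF (closedForm 0)     ∎
  where open ≈F-Reasoning
hookSum-trees (suc f) (suc m) (s≤s m≤f) = begin
  hookSum (cauchy _++_ pairs (trees f) (trees f) m)
    ≈⟨ hookSum-size m _ (sound (trees-enumerates (suc f) (suc m) (s≤s m≤f))) ⟩
  H *F sum (map childF (cauchy _++_ pairs (trees f) (trees f) m))
    ≈⟨ *F-congˡ {H} (childSum-conv (trees f) (trees f) m) ⟩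
  H *F convF (λ k → hookSum (trees f k)) (λ k → hookSum (trees f k)) m
    ≈⟨ *F-congˡ {H} (convF-cong m IH IH) ⟩
  H *F convF (λ k → polyF (closedForm k)) (λ k → polyF (closedForm k)) m
    ≈⟨ *F-congˡ {H} (convF-homomorphic _+P_ _*P_ polyF polyF polyF-+ polyF-* closedForm closedForm m) ⟨
  H *F polyF (conv closedForm closedForm m)
    ≈⟨ *F-congˡ {H} (polyF-cong (conv-closedForm m)) ⟩
  H *F polyF (ℕ→P 2 ^P m *P abel m (2z+ 0))
    ≈⟨ hookFactor-step m ⟩
  polyF (closedForm (suc m))
    ∎
  where
  open ≈F-Reasoning
  H = hookFactorF m
  IH : ∀ k → k ≤ m → hookSum (trees f k) ≈F polyF (closedForm k)
  IH k k≤m = hookSum-trees f k (ℕP.≤-trans k≤m m≤f)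

theorem1 : (n : ℕ) → 1 ≤ n → (L : List BTree) →
    Unique L → All (λ t → size t ≡ n) L → ((t : BTree) → size t ≡ n → t ∈ L) →
    sumR (map hookProd L) ≈R rhs n
theorem1 (suc m) _ L unique-L sizes-L complete-L =
  ≃⇒≈R {sumR (map hookProd L)} {rhs n}
    (≃-trans {sumR (map hookProd L)} {polyR (closedForm n)} {rhs n} Cancellable-1
      (subst (_≃ polyR (closedForm n)) (ratFun-hookSum L) (cross L≈closedForm)) (closedForm≃rhs m))
  where
  n = suc m
  L-enumerates : Enumerates (HasSize n) L
  L-enumerates = record { sound = sizes-L ; complete = complete-L ; unique = unique-L }
  L≈closedForm : hookSum L ≈F polyF (closedForm n)
  L≈closedForm = begin
    hookSum L                ≈⟨ hookSum-↭ (enumerations-↭ L-enumerates (trees-enumerates n n ℕP.≤-refl)) ⟩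
    hookSum (trees n n)      ≈⟨ hookSum-trees n n ℕP.≤-refl ⟩
    polyF (closedForm n)     ∎
    where open ≈F-Reasoning
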